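{- Let \[ F_{k,1}(q)=\sum_{n\ge 0}\frac{\left(q^{2n+2};q^2\right)_\infty\left(q^{2n+2k};q^2\right)_\infty}{\left(q^{2n+1};q^2\right)_\infty^2}\,q^{2n+1}\qquad(k\in\mathbb{N}) \] and let $\omega(q):=\sum_{n\ge0}\frac{q^{2n(n+1)}}{\left(q;q^2\right)_{n+1}^2}$ be Ramanujan's third order mock theta function. Then \[ \lim_{k\to\infty}F_{k,1}(q)=q\,\omega(q). \]
   Context: For $n\in\mathbb{N}_0\cup\{\infty\}$, $(a;q)_n:=\prod_{j=0}^{n-1}(1-aq^j)$. All series are considered for $|q|<1$ (equivalently, as formal power series, with the limit taken coefficientwise). -}

module Defs where

open import Data.Nat using (ℕ; zero; suc; _+_; _*_; _∸_; _≡ᵇ_)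
open import Data.Nat.Divisibility using (_∣?_)
open import Data.Integer using (ℤ; 0ℤ; 1ℤ) renaming (_+_ to _+ℤ_; _*_ to _*ℤ_; _-_ to _-ℤ_)
open import Data.Bool using (if_then_else_)
open import Relation.Nullary using (does)

-- Formal power series in q with integer coefficients: N ↦ coefficient of q^N.
PS : Set
PS = ℕ → ℤ

sumBelow : ℕ → (ℕ → ℤ) → ℤ
sumBelow zero    f = 0ℤ
sumBelow (suc n) f = sumBelow n f +ℤ f n

_⊗_ : PS → PS → PS
(f ⊗ g) N = sumBelow (suc N) (λ i → f i *ℤ g (N ∸ i))

one : PS
one N = if N ≡ᵇ 0 then 1ℤ else 0ℤ

mono : ℕ → PS
mono m N = if m ≡ᵇ N then 1ℤ else 0ℤ

oneMinus : ℕ → PS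
oneMinus m N = one N -ℤ mono m N

-- 1/(1 - q^m) = Σ_t q^{m t}  (only used with m ≥ 1)
geomInv : ℕ → PS
geomInv m N = if does (m ∣? N) then 1ℤ else 0ℤ

prodBelow : ℕ → (ℕ → PS) → PS
prodBelow zero    f = one
prodBelow (suc n) f = prodBelow n f ⊗ f n

pochFin : ℕ → ℕ → ℕ → PS
pochFin s d n = prodBelow n (λ j → oneMinus (s + d * j))

invPochFin : ℕ → ℕ → ℕ → PS
invPochFin s d n = prodBelow n (λ j → geomInv (s + d * j))

-- (q^s;q^d)_∞ and its reciprocal, for s,d ≥ 1: the coefficient of q^N only
-- depends on the factors with j ≤ N, so it is the coefficientwise limit.
poch∞ : ℕ → ℕ → PS
poch∞ s d N = pochFin s d (suc N) N

invPoch∞ : ℕ → ℕ → PS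
invPoch∞ s d N = invPochFin s d (suc N) N

Fterm : ℕ → ℕ → PS
Fterm k n =
  (poch∞ (2 * n + 2) 2 ⊗ poch∞ (2 * n + 2 * k) 2)
  ⊗ ((invPoch∞ (2 * n + 1) 2 ⊗ invPoch∞ (2 * n + 1) 2) ⊗ mono (2 * n + 1))

-- F_{k,1}(q) = Σ_{n≥0} Fterm k n ; Fterm k n = O(q^{2n+1}), so only n ≤ N
-- contribute to the coefficient of q^N.
F : ℕ → PS
F k N = sumBelow (suc N) (λ n → Fterm k n N)

ωterm : ℕ → PS
ωterm n = mono (2 * n * (n + 1)) ⊗ (invPochFin 1 2 (n + 1) ⊗ invPochFin 1 2 (n + 1))

-- ω(q) = Σ_{n≥0} ωterm n ; ωterm n = O(q^{2n(n+1)}), so n ≤ N suffices.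
ω : PS
ω N = sumBelow (suc N) (λ n → ωterm n N)

qω : PS
qω = mono 1 ⊗ ω

-- For k > N the factor (q^{2n+2k}; q²)_∞ of the n-th summand of F_{k,1} is ≡ 1 mod q^{N+1}, so up to q^N
-- the series F_{k,1} agrees with G = Σ_n q^{2n+1} (q^{2n+2}; q²)_∞ / (q^{2n+1}; q²)_∞². Expanding one factor
-- 1/(q^{2n+1}; q²)_∞ as Σ_m q^{(2n+1)m} / (q²; q²)_m (Euler), interchanging the two sums and summing over n by
-- the q-binomial theorem gives G = q U 1, where U j = Σ_n q^{jn} / (q; q²)_{n+1}. Both U j and
-- V j = Σ_n q^{jn+2n²+n} / ((q; q²)_{n+1} (q^j; q²)_{n+1}) solve X j = 1 + q^j X j + q X (j + 2) (for V by
-- telescoping), a recursion with a unique solution, and V 1 = ω.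
-- The q-binomial theorem Σ_n (a; q^d)_n / (q^d; q^d)_n q^{sn} = (a q^s; q^d)_∞ / (q^s; q^d)_∞ is proved the
-- same way: multiplied by (q^s; q^d)_∞, both sides satisfy Y s = (1 - a q^s) Y (s + d) and are ≡ 1 mod q^s.

{-# OPTIONS --safe #-}
module Submission where

open import Defs
open import Data.Nat as ℕ using (ℕ; zero; suc; _∸_; _≤_; _<_; z≤n; s≤s; NonZero)
import Data.Nat.Properties as ℕP
open import Data.Integer as ℤ using (ℤ; 0ℤ; 1ℤ; _+_; _*_; -_)
import Data.Integer.Properties as ℤP
open import Data.Integer.Tactic.RingSolver using (solve-∀)
import Data.Nat.Tactic.RingSolver as ℕ-Solver
open import Algebra.Bundles using (CommutativeRing)
open import Algebra.Solver.Ring.AlmostCommutativeRing using (fromCommutativeRing; _-Raw-AlmostCommutative⟶_)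
open import Data.Maybe using (Maybe; just; nothing)
open import Data.Bool using (if_then_else_)
open import Data.Product using (_,_; ∃-syntax)
open import Data.Sum using (inj₁; inj₂)
open import Data.Empty using (⊥-elim)
open import Data.Nat.Divisibility using (_∣?_; ∣⇒≤; _∣0; ∣m+n∣m⇒∣n; ∣m∣n⇒∣m+n; ∣-refl)
open import Relation.Nullary using (yes; no)
open import Relation.Binary.PropositionalEquality using (_≡_; refl; sym; trans; cong; cong₂; subst; module ≡-Reasoning)
open import Relation.Binary.Bundles using (Setoid)
import Relation.Binary.Reasoning.Setoid

sumBelow-cong< : ∀ n {f g : ℕ → ℤ} → (∀ i → i < n → f i ≡ g i) → sumBelow n f ≡ sumBelow n g
sumBelow-cong< zero    f≗g = refl
sumBelow-cong< (suc n) f≗g =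
  cong₂ _+_ (sumBelow-cong< n (λ i i<n → f≗g i (ℕP.m<n⇒m<1+n i<n))) (f≗g n ℕP.≤-refl)

sumBelow-cong : ∀ n {f g : ℕ → ℤ} → (∀ i → f i ≡ g i) → sumBelow n f ≡ sumBelow n g
sumBelow-cong n f≗g = sumBelow-cong< n (λ i _ → f≗g i)

sumBelow-zero : ∀ n {f : ℕ → ℤ} → (∀ i → i < n → f i ≡ 0ℤ) → sumBelow n f ≡ 0ℤ
sumBelow-zero zero    f≗0 = refl
sumBelow-zero (suc n) f≗0 =
  cong₂ _+_ (sumBelow-zero n (λ i i<n → f≗0 i (ℕP.m<n⇒m<1+n i<n))) (f≗0 n ℕP.≤-refl)

sumBelow-+ : ∀ n (f g : ℕ → ℤ) → sumBelow n (λ i → f i + g i) ≡ sumBelow n f + sumBelow n g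
sumBelow-+ zero    f g = refl
sumBelow-+ (suc n) f g =
  trans (cong (_+ (f n + g n)) (sumBelow-+ n f g)) (interchange (sumBelow n f) (sumBelow n g) (f n) (g n))
  where
  interchange : ∀ a b c d → (a + b) + (c + d) ≡ (a + c) + (b + d)
  interchange = solve-∀

*-distribˡ-sumBelow : ∀ n c (f : ℕ → ℤ) → c * sumBelow n f ≡ sumBelow n (λ i → c * f i)
*-distribˡ-sumBelow zero    c f = ℤP.*-zeroʳ c
*-distribˡ-sumBelow (suc n) c f =
  trans (ℤP.*-distribˡ-+ c (sumBelow n f) (f n)) (cong (_+ c * f n) (*-distribˡ-sumBelow n c f))

neg-distrib-sumBelow : ∀ n (f : ℕ → ℤ) → - sumBelow n f ≡ sumBelow n (λ i → - f i)
neg-distrib-sumBelow zero    f = refl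
neg-distrib-sumBelow (suc n) f =
  trans (ℤP.neg-distrib-+ (sumBelow n f) (f n)) (cong (_+ - f n) (neg-distrib-sumBelow n f))

sumBelow-unfoldˡ : ∀ n (f : ℕ → ℤ) → sumBelow (suc n) f ≡ f 0 + sumBelow n (λ i → f (suc i))
sumBelow-unfoldˡ zero    f = trans (ℤP.+-identityˡ (f 0)) (sym (ℤP.+-identityʳ (f 0)))
sumBelow-unfoldˡ (suc n) f = trans (cong (_+ f (suc n)) (sumBelow-unfoldˡ n f)) (ℤP.+-assoc (f 0) _ _)

sumBelow-swap : ∀ n m (f : ℕ → ℕ → ℤ) →
  sumBelow n (λ i → sumBelow m (f i)) ≡ sumBelow m (λ j → sumBelow n (λ i → f i j))
sumBelow-swap zero    m f = sym (sumBelow-zero m (λ _ _ → refl))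
sumBelow-swap (suc n) m f =
  trans (cong (_+ sumBelow m (f n)) (sumBelow-swap n m f))
        (sym (sumBelow-+ m (λ j → sumBelow n (λ i → f i j)) (f n)))

sumBelow-pad : ∀ {n} M {f : ℕ → ℤ} → n ≤ M → (∀ i → n ≤ i → f i ≡ 0ℤ) → sumBelow M f ≡ sumBelow n f
sumBelow-pad zero    z≤n    f≗0 = refl
sumBelow-pad (suc M) n≤1+M f≗0 with ℕP.m≤n⇒m<n∨m≡n n≤1+M
... | inj₂ refl = refl
... | inj₁ n<1+M =
  trans (cong₂ _+_ (sumBelow-pad M (ℕP.≤-pred n<1+M) f≗0) (f≗0 M (ℕP.≤-pred n<1+M))) (ℤP.+-identityʳ _)

sumBelow-reverse : ∀ n (f : ℕ → ℤ) → sumBelow n f ≡ sumBelow n (λ i → f (n ∸ suc i))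
sumBelow-reverse zero    f = refl
sumBelow-reverse (suc n) f =
  trans (cong (_+ f n) (sumBelow-reverse n f))
        (trans (ℤP.+-comm _ (f n)) (sym (sumBelow-unfoldˡ n (λ i → f (n ∸ i)))))

sumBelow-telescope : ∀ n (s : ℕ → ℤ) → sumBelow n (λ i → s i + - s (suc i)) ≡ s 0 + - s n
sumBelow-telescope zero    s = sym (ℤP.+-inverseʳ (s 0))
sumBelow-telescope (suc n) s =
  trans (cong (_+ (s n + - s (suc n))) (sumBelow-telescope n s)) (cancel (s 0) (s n) (s (suc n)))
  where
  cancel : ∀ a b c → (a + - b) + (b + - c) ≡ a + - c
  cancel = solve-∀

-- The ring ℤ[[q]]

infix  4 _≈_
infixl 6 _⊕_
infix  8 ⊖_

_≈_ : PS → PS → Set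
f ≈ g = ∀ N → f N ≡ g N

_⊕_ : PS → PS → PS
(f ⊕ g) N = f N + g N

⊖_ : PS → PS
(⊖ f) N = - f N

𝟘 : PS
𝟘 N = 0ℤ

_·_ : ℤ → PS → PS
(c · f) N = c * f N

tail : PS → PS
tail f N = f (suc N)

≈-refl : ∀ {f} → f ≈ f
≈-refl N = refl

≈-sym : ∀ {f g} → f ≈ g → g ≈ f
≈-sym f≈g N = sym (f≈g N)

≈-trans : ∀ {f g h} → f ≈ g → g ≈ h → f ≈ h
≈-trans f≈g g≈h N = trans (f≈g N) (g≈h N)

⊗-zero : ∀ f g → (f ⊗ g) 0 ≡ f 0 * g 0
⊗-zero f g = ℤP.+-identityˡ _

⊗-tail : ∀ f g N → (f ⊗ g) (suc N) ≡ f 0 * g (suc N) + (tail f ⊗ g) N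
⊗-tail f g N = sumBelow-unfoldˡ (suc N) (λ i → f i * g (suc N ∸ i))

⊗-congˡ : ∀ {f f′} g → f ≈ f′ → f ⊗ g ≈ f′ ⊗ g
⊗-congˡ g f≈f′ N = sumBelow-cong (suc N) (λ i → cong (_* g (N ∸ i)) (f≈f′ i))

⊗-congʳ : ∀ f {g g′} → g ≈ g′ → f ⊗ g ≈ f ⊗ g′
⊗-congʳ f g≈g′ N = sumBelow-cong (suc N) (λ i → cong (f i *_) (g≈g′ (N ∸ i)))

⊗-cong : ∀ {f f′ g g′} → f ≈ f′ → g ≈ g′ → f ⊗ g ≈ f′ ⊗ g′
⊗-cong {f′ = f′} {g = g} f≈f′ g≈g′ = ≈-trans (⊗-congˡ g f≈f′) (⊗-congʳ f′ g≈g′)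

⊗-distribʳ : ∀ f g h → (f ⊕ g) ⊗ h ≈ (f ⊗ h) ⊕ (g ⊗ h)
⊗-distribʳ f g h N =
  trans (sumBelow-cong (suc N) (λ i → ℤP.*-distribʳ-+ (h (N ∸ i)) (f i) (g i)))
        (sumBelow-+ (suc N) (λ i → f i * h (N ∸ i)) (λ i → g i * h (N ∸ i)))

·-⊗ : ∀ c f g → (c · f) ⊗ g ≈ c · (f ⊗ g)
·-⊗ c f g N =
  trans (sumBelow-cong (suc N) (λ i → ℤP.*-assoc c (f i) (g (N ∸ i))))
        (sym (*-distribˡ-sumBelow (suc N) c (λ i → f i * g (N ∸ i))))

⊗-assoc : ∀ f g h → (f ⊗ g) ⊗ h ≈ f ⊗ (g ⊗ h)
⊗-assoc f g h zero = begin
  ((f ⊗ g) ⊗ h) 0   ≡⟨ ⊗-zero (f ⊗ g) h ⟩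
  (f ⊗ g) 0 * h 0   ≡⟨ cong (_* h 0) (⊗-zero f g) ⟩
  f 0 * g 0 * h 0   ≡⟨ ℤP.*-assoc (f 0) (g 0) (h 0) ⟩
  f 0 * (g 0 * h 0) ≡⟨ cong (f 0 *_) (sym (⊗-zero g h)) ⟩
  f 0 * (g ⊗ h) 0   ≡⟨ sym (⊗-zero f (g ⊗ h)) ⟩
  (f ⊗ (g ⊗ h)) 0   ∎
  where open ≡-Reasoning
⊗-assoc f g h (suc N) = begin
  ((f ⊗ g) ⊗ h) (suc N)
    ≡⟨ ⊗-tail (f ⊗ g) h N ⟩
  (f ⊗ g) 0 * h (suc N) + (tail (f ⊗ g) ⊗ h) N
    ≡⟨ cong₂ _+_ (cong (_* h (suc N)) (⊗-zero f g)) (⊗-congˡ h (⊗-tail f g) N) ⟩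
  f 0 * g 0 * h (suc N) + (((f 0 · tail g) ⊕ (tail f ⊗ g)) ⊗ h) N
    ≡⟨ cong (f 0 * g 0 * h (suc N) +_) (trans (⊗-distribʳ (f 0 · tail g) (tail f ⊗ g) h N)
         (cong₂ _+_ (·-⊗ (f 0) (tail g) h N) (⊗-assoc (tail f) g h N))) ⟩
  f 0 * g 0 * h (suc N) + (f 0 * (tail g ⊗ h) N + (tail f ⊗ (g ⊗ h)) N)
    ≡⟨ regroup (f 0) (g 0) (h (suc N)) ((tail g ⊗ h) N) ((tail f ⊗ (g ⊗ h)) N) ⟩
  f 0 * (g 0 * h (suc N) + (tail g ⊗ h) N) + (tail f ⊗ (g ⊗ h)) N
    ≡⟨ cong (λ x → f 0 * x + (tail f ⊗ (g ⊗ h)) N) (sym (⊗-tail g h N)) ⟩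
  f 0 * (g ⊗ h) (suc N) + (tail f ⊗ (g ⊗ h)) N
    ≡⟨ sym (⊗-tail f (g ⊗ h) N) ⟩
  (f ⊗ (g ⊗ h)) (suc N) ∎
  where
  open ≡-Reasoning
  regroup : ∀ a b c d e → a * b * c + (a * d + e) ≡ a * (b * c + d) + e
  regroup = solve-∀

⊗-comm : ∀ f g → f ⊗ g ≈ g ⊗ f
⊗-comm f g N =
  trans (sumBelow-reverse (suc N) (λ i → f i * g (N ∸ i)))
        (sumBelow-cong< (suc N) (λ i i<1+N →
          trans (cong (λ j → f (N ∸ i) * g j) (ℕP.m∸[m∸n]≡n (ℕP.≤-pred i<1+N))) (ℤP.*-comm (f (N ∸ i)) (g i))))

⊗-identityˡ : ∀ f → one ⊗ f ≈ f
⊗-identityˡ f N =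
  trans (sumBelow-unfoldˡ N (λ i → one i * f (N ∸ i)))
        (trans (cong₂ _+_ (ℤP.*-identityˡ (f N)) (sumBelow-zero N (λ _ _ → refl))) (ℤP.+-identityʳ (f N)))

⊗-identityʳ : ∀ f → f ⊗ one ≈ f
⊗-identityʳ f = ≈-trans (⊗-comm f one) (⊗-identityˡ f)

⊗-distribˡ : ∀ f g h → f ⊗ (g ⊕ h) ≈ (f ⊗ g) ⊕ (f ⊗ h)
⊗-distribˡ f g h N =
  trans (⊗-comm f (g ⊕ h) N) (trans (⊗-distribʳ g h f N) (cong₂ _+_ (⊗-comm g f N) (⊗-comm h f N)))

⊕-⊗-commutativeRing : CommutativeRing _ _
⊕-⊗-commutativeRing = record
  { Carrier = PS ; _≈_ = _≈_ ; _+_ = _⊕_ ; _*_ = _⊗_ ; -_ = ⊖_ ; 0# = 𝟘 ; 1# = one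
  ; isCommutativeRing = record
    { isRing = record
      { +-isAbelianGroup = record
        { isGroup = record
          { isMonoid = record
            { isSemigroup = record
              { isMagma = record
                { isEquivalence = record { refl = ≈-refl ; sym = ≈-sym ; trans = ≈-trans }
                ; ∙-cong = λ f≈f′ g≈g′ N → cong₂ _+_ (f≈f′ N) (g≈g′ N) }
              ; assoc = λ f g h N → ℤP.+-assoc (f N) (g N) (h N) }
            ; identity = (λ f N → ℤP.+-identityˡ (f N)) , (λ f N → ℤP.+-identityʳ (f N)) }
          ; inverse = (λ f N → ℤP.+-inverseˡ (f N)) , (λ f N → ℤP.+-inverseʳ (f N))
          ; ⁻¹-cong = λ f≈g N → cong -_ (f≈g N) }
        ; comm = λ f g N → ℤP.+-comm (f N) (g N) }
      ; *-cong = ⊗-cong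
      ; *-assoc = ⊗-assoc
      ; *-identity = ⊗-identityˡ , ⊗-identityʳ
      ; distrib = ⊗-distribˡ , (λ h f g → ⊗-distribʳ f g h) }
    ; *-comm = ⊗-comm } }

const : ℤ → PS
const c N = if N ℕ.≡ᵇ 0 then c else 0ℤ

const-homomorphism : CommutativeRing.rawRing ℤP.+-*-commutativeRing
                       -Raw-AlmostCommutative⟶ fromCommutativeRing ⊕-⊗-commutativeRing
const-homomorphism = record
  { ⟦_⟧    = const
  ; +-homo = λ { a b zero → refl ; a b (suc N) → refl }
  ; *-homo = *-homo
  ; -‿homo = λ { a zero → refl ; a (suc N) → refl }
  ; 0-homo = λ { zero → refl ; (suc N) → refl }
  ; 1-homo = λ N → refl }
  where
  *-homo : ∀ a b → const (a * b) ≈ const a ⊗ const b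
  *-homo a b zero    = sym (ℤP.+-identityˡ (a * b))
  *-homo a b (suc N) = sym (trans (sumBelow-unfoldˡ (suc N) (λ i → const a i * const b (suc N ∸ i)))
    (cong₂ _+_ (ℤP.*-zeroʳ a) (sumBelow-zero (suc N) (λ _ _ → refl))))

const-≟ : ∀ a b → Maybe (const a ≈ const b)
const-≟ a b with a ℤ.≟ b
... | yes refl = just ≈-refl
... | no _     = nothing

open import Algebra.Solver.Ring _ _ const-homomorphism const-≟ using (solve; _:=_; _:+_; _:*_; _:-_; con)

PS-setoid : Setoid _ _
PS-setoid = CommutativeRing.setoid ⊕-⊗-commutativeRing

module ≈-Reasoning = Relation.Binary.Reasoning.Setoid PS-setoid

⊕-cong : ∀ {f f′ g g′} → f ≈ f′ → g ≈ g′ → f ⊕ g ≈ f′ ⊕ g′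
⊕-cong f≈f′ g≈g′ N = cong₂ _+_ (f≈f′ N) (g≈g′ N)

⊕-congʳ : ∀ f {g g′} → g ≈ g′ → f ⊕ g ≈ f ⊕ g′
⊕-congʳ f g≈g′ N = cong (f N +_) (g≈g′ N)

⊖-cong : ∀ {f g} → f ≈ g → ⊖ f ≈ ⊖ g
⊖-cong f≈g N = cong -_ (f≈g N)

≡⇒≈ : ∀ {f g} → f ≡ g → f ≈ g
≡⇒≈ refl = ≈-refl

unit-cancelˡ : ∀ u v x y → u ⊗ v ≈ one → u ⊗ x ≈ y → x ≈ v ⊗ y
unit-cancelˡ u v x y uv≈1 ux≈y = begin
  x                ≈⟨ ≈-sym (⊗-identityˡ x) ⟩
  one ⊗ x          ≈⟨ ⊗-congˡ x (≈-trans (≈-sym uv≈1) (⊗-comm u v)) ⟩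
  (v ⊗ u) ⊗ x      ≈⟨ ⊗-assoc v u x ⟩
  v ⊗ (u ⊗ x)      ≈⟨ ⊗-congʳ v ux≈y ⟩
  v ⊗ y            ∎
  where open ≈-Reasoning

difference-swap : ∀ A B C D → A ⊕ ⊖ B ≈ C ⊕ ⊖ D → A ⊕ ⊖ C ≈ B ⊕ ⊖ D
difference-swap A B C D A-B≈C-D = begin
  A ⊕ ⊖ C                   ≈⟨ add-and-subtract A B C ⟩
  (A ⊕ ⊖ B) ⊕ ⊖ C ⊕ B       ≈⟨ ⊕-cong (⊕-cong A-B≈C-D (≈-refl {⊖ C})) (≈-refl {B}) ⟩
  (C ⊕ ⊖ D) ⊕ ⊖ C ⊕ B       ≈⟨ cancel B C D ⟩
  B ⊕ ⊖ D                   ∎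
  where
  open ≈-Reasoning
  add-and-subtract : ∀ A B C → A ⊕ ⊖ C ≈ (A ⊕ ⊖ B) ⊕ ⊖ C ⊕ B
  add-and-subtract = solve 3 (λ A B C → A :- C := ((A :- B) :- C) :+ B) ≈-refl
  cancel : ∀ B C D → (C ⊕ ⊖ D) ⊕ ⊖ C ⊕ B ≈ B ⊕ ⊖ D
  cancel = solve 3 (λ B C D → ((C :- D) :- C) :+ B := B :- D) ≈-refl

rearrange-recursion : ∀ c t u X X′ → (one ⊕ ⊖ t) ⊗ X ⊕ ⊖ (u ⊗ X′) ≈ c → X ≈ c ⊕ t ⊗ X ⊕ u ⊗ X′
rearrange-recursion c t u X X′ eq = begin
  X
    ≈⟨ regroup t X (u ⊗ X′) ⟩
  ((one ⊕ ⊖ t) ⊗ X ⊕ ⊖ (u ⊗ X′)) ⊕ t ⊗ X ⊕ u ⊗ X′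
    ≈⟨ ⊕-cong (⊕-cong eq (≈-refl {t ⊗ X})) (≈-refl {u ⊗ X′}) ⟩
  c ⊕ t ⊗ X ⊕ u ⊗ X′ ∎
  where
  open ≈-Reasoning
  regroup : ∀ t X Y → X ≈ ((one ⊕ ⊖ t) ⊗ X ⊕ ⊖ Y) ⊕ t ⊗ X ⊕ Y
  regroup = solve 3 (λ t X Y → X := ((con 1ℤ :- t) :* X :- Y) :+ t :* X :+ Y) ≈-refl

-- Congruences modulo powers of q

infix 4 _≈[_]_ q^_∣_

_≈[_]_ : PS → ℕ → PS → Set
f ≈[ m ] g = ∀ N → N < m → f N ≡ g N

q^_∣_ : ℕ → PS → Set
q^ m ∣ f = f ≈[ m ] 𝟘

≈⇒≈[] : ∀ {m f g} → f ≈ g → f ≈[ m ] g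
≈⇒≈[] f≈g N _ = f≈g N

≈[]-sym : ∀ {m f g} → f ≈[ m ] g → g ≈[ m ] f
≈[]-sym f≈g N N<m = sym (f≈g N N<m)

≈[]-trans : ∀ {m f g h} → f ≈[ m ] g → g ≈[ m ] h → f ≈[ m ] h
≈[]-trans f≈g g≈h N N<m = trans (f≈g N N<m) (g≈h N N<m)

≈[]-weaken : ∀ {m m′ f g} → m ≤ m′ → f ≈[ m′ ] g → f ≈[ m ] g
≈[]-weaken m≤m′ f≈g N N<m = f≈g N (ℕP.<-≤-trans N<m m≤m′)

≈[]-⊗ : ∀ {m f f′ g g′} → f ≈[ m ] f′ → g ≈[ m ] g′ → f ⊗ g ≈[ m ] f′ ⊗ g′
≈[]-⊗ f≈f′ g≈g′ N N<m = sumBelow-cong< (suc N) λ i i≤N →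
  cong₂ _*_ (f≈f′ i (ℕP.<-≤-trans i≤N N<m)) (g≈g′ (N ∸ i) (ℕP.≤-<-trans (ℕP.m∸n≤m N i) N<m))

∣-cong : ∀ {m f g} → f ≈ g → q^ m ∣ f → q^ m ∣ g
∣-cong f≈g m∣f N N<m = trans (sym (f≈g N)) (m∣f N N<m)

∣-⊕ : ∀ {m f g} → q^ m ∣ f → q^ m ∣ g → q^ m ∣ f ⊕ g
∣-⊕ m∣f m∣g N N<m = cong₂ _+_ (m∣f N N<m) (m∣g N N<m)

∣-⊖ : ∀ {m f} → q^ m ∣ f → q^ m ∣ ⊖ f
∣-⊖ m∣f N N<m = cong -_ (m∣f N N<m)

∣-⊗ : ∀ {a b f g} → q^ a ∣ f → q^ b ∣ g → q^ (a ℕ.+ b) ∣ f ⊗ g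
∣-⊗ {a} {b} {f} {g} a∣f b∣g N N<a+b = sumBelow-zero (suc N) (λ i i≤N → term-vanishes i (ℕP.≤-pred i≤N))
  where
  term-vanishes : ∀ i → i ≤ N → f i * g (N ∸ i) ≡ 0ℤ
  term-vanishes i i≤N with i ℕP.<? a
  ... | yes i<a = cong (_* g (N ∸ i)) (a∣f i i<a)
  ... | no  i≮a = trans (cong (f i *_) (b∣g (N ∸ i) N-i<b)) (ℤP.*-zeroʳ (f i))
    where
    open ℕP.≤-Reasoning
    N-i<b : N ∸ i < b
    N-i<b = ℕP.+-cancelˡ-< a (N ∸ i) b (begin-strict
      a ℕ.+ (N ∸ i) ≤⟨ ℕP.+-monoˡ-≤ (N ∸ i) (ℕP.≮⇒≥ i≮a) ⟩
      i ℕ.+ (N ∸ i) ≡⟨ ℕP.m+[n∸m]≡n i≤N ⟩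
      N             <⟨ N<a+b ⟩
      a ℕ.+ b       ∎)

∣-⊗ʳ : ∀ {a f} → q^ a ∣ f → ∀ g → q^ a ∣ f ⊗ g
∣-⊗ʳ {a} a∣f g N N<a = ∣-⊗ {b = 0} {g = g} a∣f (λ _ ()) N (subst (N <_) (sym (ℕP.+-identityʳ a)) N<a)

∣-⊗ˡ : ∀ {a g} f → q^ a ∣ g → q^ a ∣ f ⊗ g
∣-⊗ˡ {g = g} f a∣g = ∣-cong (⊗-comm g f) (∣-⊗ʳ a∣g f)

∣-diff⇒≈[] : ∀ {m f g} → q^ m ∣ f ⊕ ⊖ g → f ≈[ m ] g
∣-diff⇒≈[] {f = f} {g} m∣f-g N N<m = ℤP.i-j≡0⇒i≡j (f N) (g N) (m∣f-g N N<m)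

≈[]⇒∣-diff : ∀ {m f g} → f ≈[ m ] g → q^ m ∣ f ⊕ ⊖ g
≈[]⇒∣-diff f≈g N N<m = ℤP.i≡j⇒i-j≡0 (f≈g N N<m)

one-minus≈[]one : ∀ {m g} → q^ m ∣ g → one ⊕ ⊖ g ≈[ m ] one
one-minus≈[]one {g = g} m∣g N N<m = trans (cong (λ x → one N + - x) (m∣g N N<m)) (ℤP.+-identityʳ (one N))

data Offset (a : ℕ) : ℕ → Set where
  below : ∀ {N} → N < a → Offset a N
  above : ∀ M → Offset a (a ℕ.+ M)

offset : ∀ a N → Offset a N
offset a N with a ℕP.≤? N
... | yes a≤N = subst (Offset a) (ℕP.m+[n∸m]≡n a≤N) (above (N ∸ a))
... | no  a≰N = below (ℕP.≰⇒> a≰N)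

mono-zero : mono 0 ≈ one
mono-zero zero    = refl
mono-zero (suc N) = refl

q^m∣mono : ∀ m → q^ m ∣ mono m
q^m∣mono (suc m) zero    _   = refl
q^m∣mono (suc m) (suc N) N<m = q^m∣mono m N (ℕP.≤-pred N<m)

mono-shift : ∀ c a N → mono (c ℕ.+ a) (c ℕ.+ N) ≡ mono a N
mono-shift zero    a N = refl
mono-shift (suc c) a N = mono-shift c a N

mono⊗-at-+ : ∀ a f M → (mono a ⊗ f) (a ℕ.+ M) ≡ f M
mono⊗-at-+ zero    f M = trans (⊗-congˡ f mono-zero M) (⊗-identityˡ f M)
mono⊗-at-+ (suc a) f M =
  trans (⊗-tail (mono (suc a)) f (a ℕ.+ M)) (trans (ℤP.+-identityˡ _) (mono⊗-at-+ a f M))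

q^a∣mono⊗ : ∀ a g → q^ a ∣ mono a ⊗ g
q^a∣mono⊗ a = ∣-⊗ʳ (q^m∣mono a)

mono-+ : ∀ a b → mono a ⊗ mono b ≈ mono (a ℕ.+ b)
mono-+ a b N with offset a N
... | below N<a = trans (q^a∣mono⊗ a (mono b) N N<a)
                        (sym (q^m∣mono (a ℕ.+ b) N (ℕP.<-≤-trans N<a (ℕP.m≤m+n a b))))
... | above M   = trans (mono⊗-at-+ a (mono b) M) (sym (mono-shift a b M))

mono-cong : ∀ {a b} → a ≡ b → mono a ≈ mono b
mono-cong refl = ≈-refl

mono-split : ∀ a b {c} → a ℕ.+ b ≡ c → mono c ≈ mono a ⊗ mono b
mono-split a b refl = ≈-sym (mono-+ a b)

geomInv≈[]one : ∀ m → geomInv m ≈[ m ] one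
geomInv≈[]one m zero    _   with m ∣? 0
... | yes _    = refl
... | no  m∤0 = ⊥-elim (m∤0 (m ∣0))
geomInv≈[]one m (suc N) N<m with m ∣? suc N
... | yes m∣N = ⊥-elim (ℕP.<-irrefl refl (ℕP.<-≤-trans N<m (∣⇒≤ m∣N)))
... | no  _   = refl

geomInv-periodic : ∀ m M → geomInv m (m ℕ.+ M) ≡ geomInv m M
geomInv-periodic m M with m ∣? (m ℕ.+ M) | m ∣? M
... | yes _     | yes _   = refl
... | no  _     | no  _   = refl
... | yes m∣m+M | no  m∤M = ⊥-elim (m∤M (∣m+n∣m⇒∣n m∣m+M ∣-refl))
... | no  m∤m+M | yes m∣M = ⊥-elim (m∤m+M (∣m∣n⇒∣m+n ∣-refl m∣M))

mono⊗geomInv : ∀ m → 1 ≤ m → mono m ⊗ geomInv m ≈ geomInv m ⊕ ⊖ one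
mono⊗geomInv m 1≤m N with offset m N
... | below N<m = trans (q^a∣mono⊗ m (geomInv m) N N<m)
                        (sym (trans (cong (λ x → x + - one N) (geomInv≈[]one m N N<m)) (ℤP.+-inverseʳ (one N))))
mono⊗geomInv (suc m) _ N | above M =
  trans (mono⊗-at-+ (suc m) (geomInv (suc m)) M)
        (sym (trans (ℤP.+-identityʳ _) (geomInv-periodic (suc m) M)))

geomInv-inverseʳ : ∀ m → 1 ≤ m → geomInv m ⊗ oneMinus m ≈ one
geomInv-inverseʳ m 1≤m = begin
  geomInv m ⊗ (one ⊕ ⊖ mono m)           ≈⟨ expand (geomInv m) (mono m) ⟩
  geomInv m ⊕ ⊖ (mono m ⊗ geomInv m)     ≈⟨ ⊕-congʳ (geomInv m) (⊖-cong (mono⊗geomInv m 1≤m)) ⟩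
  geomInv m ⊕ ⊖ (geomInv m ⊕ ⊖ one)     ≈⟨ cancel (geomInv m) ⟩
  one                                     ∎
  where
  open ≈-Reasoning
  expand : ∀ g x → g ⊗ (one ⊕ ⊖ x) ≈ g ⊕ ⊖ (x ⊗ g)
  expand = solve 2 (λ g x → g :* (con 1ℤ :- x) := g :- (x :* g)) ≈-refl
  cancel : ∀ g → g ⊕ ⊖ (g ⊕ ⊖ one) ≈ one
  cancel = solve 1 (λ g → g :- (g :- con 1ℤ) := con 1ℤ) ≈-refl

-- Infinite sums and products

-- Σ∞ a and Π∞ f are the q-adic sum and product only for Summable a and Multipliable f.
Σ∞ : (ℕ → PS) → PS
Σ∞ a N = sumBelow (suc N) (λ n → a n N)

Summable : (ℕ → PS) → Set
Summable a = ∀ n → q^ n ∣ a n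

summable-mono⊗ : ∀ (e : ℕ → ℕ) (c : ℕ → PS) → (∀ n → n ≤ e n) → Summable (λ n → mono (e n) ⊗ c n)
summable-mono⊗ e c n≤e n = ≈[]-weaken (n≤e n) (q^a∣mono⊗ (e n) (c n))

Σ∞-truncate : ∀ {a} → Summable a → ∀ {N} M → N < M → Σ∞ a N ≡ sumBelow M (λ n → a n N)
Σ∞-truncate {a} a-summable {N} M N<M = sym (sumBelow-pad M N<M (λ n N<n → a-summable n N N<n))

Σ∞-cong : ∀ {a b} → (∀ n → a n ≈ b n) → Σ∞ a ≈ Σ∞ b
Σ∞-cong a≈b N = sumBelow-cong (suc N) (λ n → a≈b n N)

Σ∞-difference : ∀ a b → Σ∞ (λ n → a n ⊕ ⊖ b n) ≈ Σ∞ a ⊕ ⊖ Σ∞ b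
Σ∞-difference a b N =
  trans (sumBelow-+ (suc N) (λ n → a n N) (λ n → - b n N))
        (cong (Σ∞ a N +_) (sym (neg-distrib-sumBelow (suc N) (λ n → b n N))))

⊗-Σ∞ : ∀ {a} c → Summable a → c ⊗ Σ∞ a ≈ Σ∞ (λ n → c ⊗ a n)
⊗-Σ∞ {a} c a-summable N = begin
  sumBelow (suc N) (λ i → c i * Σ∞ a (N ∸ i))
    ≡⟨ sumBelow-cong (suc N) (λ i → cong (c i *_) (Σ∞-truncate a-summable (suc N) (s≤s (ℕP.m∸n≤m N i)))) ⟩
  sumBelow (suc N) (λ i → c i * sumBelow (suc N) (λ n → a n (N ∸ i)))
    ≡⟨ sumBelow-cong (suc N) (λ i → *-distribˡ-sumBelow (suc N) (c i) (λ n → a n (N ∸ i))) ⟩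
  sumBelow (suc N) (λ i → sumBelow (suc N) (λ n → c i * a n (N ∸ i)))
    ≡⟨ sumBelow-swap (suc N) (suc N) (λ i n → c i * a n (N ∸ i)) ⟩
  Σ∞ (λ n → c ⊗ a n) N ∎
  where open ≡-Reasoning

Σ∞-unfoldˡ : ∀ {a} → Summable a → Σ∞ a ≈ a 0 ⊕ Σ∞ (λ n → a (suc n))
Σ∞-unfoldˡ {a} a-summable N =
  trans (sumBelow-unfoldˡ N (λ n → a n N))
        (cong (a 0 N +_) (sym (sumBelow-pad (suc N) (ℕP.n≤1+n N) (λ n N≤n → a-summable (suc n) N (s≤s N≤n)))))

Σ∞-telescope : ∀ {s} → Summable s → Σ∞ (λ n → s n ⊕ ⊖ s (suc n)) ≈ s 0
Σ∞-telescope {s} s-summable N =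
  trans (sumBelow-telescope (suc N) (λ n → s n N))
        (trans (cong (λ x → s 0 N + - x) (s-summable (suc N) N ℕP.≤-refl)) (ℤP.+-identityʳ _))

Σ∞-swap : ∀ (b : ℕ → ℕ → PS) → Σ∞ (λ n → Σ∞ (b n)) ≈ Σ∞ (λ m → Σ∞ (λ n → b n m))
Σ∞-swap b N = sumBelow-swap (suc N) (suc N) (λ n m → b n m N)

∣-Σ∞ : ∀ {k a} → (∀ n → q^ k ∣ a n) → q^ k ∣ Σ∞ a
∣-Σ∞ k∣a N N<k = sumBelow-zero (suc N) (λ n _ → k∣a n N N<k)

prodBelow-cong : ∀ n {f g} → (∀ j → f j ≈ g j) → prodBelow n f ≈ prodBelow n g
prodBelow-cong zero    f≈g = ≈-refl
prodBelow-cong (suc n) f≈g = ⊗-cong (prodBelow-cong n f≈g) (f≈g n)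

prodBelow-≈one : ∀ n {f} → (∀ j → f j ≈ one) → prodBelow n f ≈ one
prodBelow-≈one zero    f≈1 = ≈-refl
prodBelow-≈one (suc n) f≈1 = ≈-trans (⊗-cong (prodBelow-≈one n f≈1) (f≈1 n)) (⊗-identityˡ one)

prodBelow-unfoldˡ : ∀ n f → prodBelow (suc n) f ≈ f 0 ⊗ prodBelow n (λ j → f (suc j))
prodBelow-unfoldˡ zero    f = ⊗-comm one (f 0)
prodBelow-unfoldˡ (suc n) f =
  ≈-trans (⊗-congˡ (f (suc n)) (prodBelow-unfoldˡ n f)) (⊗-assoc (f 0) (prodBelow n (λ j → f (suc j))) (f (suc n)))

⊗-interchange : ∀ a b c d → (a ⊗ b) ⊗ (c ⊗ d) ≈ (a ⊗ c) ⊗ (b ⊗ d)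
⊗-interchange = solve 4 (λ a b c d → (a :* b) :* (c :* d) := (a :* c) :* (b :* d)) ≈-refl

prodBelow-⊗ : ∀ n f g → prodBelow n f ⊗ prodBelow n g ≈ prodBelow n (λ j → f j ⊗ g j)
prodBelow-⊗ zero    f g = ⊗-identityˡ one
prodBelow-⊗ (suc n) f g =
  ≈-trans (⊗-interchange (prodBelow n f) (f n) (prodBelow n g) (g n)) (⊗-congˡ (f n ⊗ g n) (prodBelow-⊗ n f g))

prodBelow≈[]one : ∀ {m} n {f} → (∀ j → f j ≈[ m ] one) → prodBelow n f ≈[ m ] one
prodBelow≈[]one zero    f≈1 = ≈⇒≈[] ≈-refl
prodBelow≈[]one (suc n) f≈1 = ≈[]-trans (≈[]-⊗ (prodBelow≈[]one n f≈1) (f≈1 n)) (≈⇒≈[] (⊗-identityˡ one))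

prodBelow-pad : ∀ {m n} M {f} → n ≤ M → (∀ j → n ≤ j → f j ≈[ m ] one) → prodBelow M f ≈[ m ] prodBelow n f
prodBelow-pad zero    z≤n    f≈1 = ≈⇒≈[] ≈-refl
prodBelow-pad (suc M) n≤1+M f≈1 with ℕP.m≤n⇒m<n∨m≡n n≤1+M
... | inj₂ refl = ≈⇒≈[] ≈-refl
... | inj₁ n<1+M =
  ≈[]-trans (≈[]-⊗ (prodBelow-pad M (ℕP.≤-pred n<1+M) f≈1) (f≈1 M (ℕP.≤-pred n<1+M))) (≈⇒≈[] (⊗-identityʳ _))

Π∞ : (ℕ → PS) → PS
Π∞ f N = prodBelow (suc N) f N

Multipliable : (ℕ → PS) → Set
Multipliable f = ∀ j → f j ≈[ suc j ] one

multipliable-tail : ∀ {f} → Multipliable f → Multipliable (λ j → f (suc j))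
multipliable-tail f-mult j = ≈[]-weaken (ℕP.n≤1+n (suc j)) (f-mult (suc j))

Π∞≈[]prodBelow : ∀ {f} → Multipliable f → ∀ {N} M → N < M → Π∞ f ≈[ suc N ] prodBelow M f
Π∞≈[]prodBelow f-mult M N<M i i≤N =
  sym (prodBelow-pad M (ℕP.≤-trans i≤N N<M) (λ j i<j → ≈[]-weaken (ℕP.m≤n⇒m≤1+n i<j) (f-mult j)) i ℕP.≤-refl)

Π∞-cong : ∀ {f g} → (∀ j → f j ≈ g j) → Π∞ f ≈ Π∞ g
Π∞-cong f≈g N = prodBelow-cong (suc N) f≈g N

Π∞-≈one : ∀ {f} → (∀ j → f j ≈ one) → Π∞ f ≈ one
Π∞-≈one f≈1 N = prodBelow-≈one (suc N) f≈1 N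

Π∞≈[]one : ∀ {m f} → (∀ j → f j ≈[ m ] one) → Π∞ f ≈[ m ] one
Π∞≈[]one f≈1 N N<m = prodBelow≈[]one (suc N) f≈1 N N<m

Π∞-unfoldˡ : ∀ {f} → Multipliable f → Π∞ f ≈ f 0 ⊗ Π∞ (λ j → f (suc j))
Π∞-unfoldˡ {f} f-mult N =
  trans (Π∞≈[]prodBelow f-mult (suc (suc N)) (ℕP.n≤1+n (suc N)) N ℕP.≤-refl)
        (trans (prodBelow-unfoldˡ (suc N) f N)
               (≈[]-⊗ (≈⇒≈[] (≈-refl {f 0})) (≈[]-sym (Π∞≈[]prodBelow (multipliable-tail f-mult) (suc N) ℕP.≤-refl))
                 N ℕP.≤-refl))

Π∞-⊗ : ∀ {f g} → Multipliable f → Multipliable g → Π∞ f ⊗ Π∞ g ≈ Π∞ (λ j → f j ⊗ g j)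
Π∞-⊗ {f} {g} f-mult g-mult N =
  trans (≈[]-⊗ (Π∞≈[]prodBelow f-mult (suc N) ℕP.≤-refl) (Π∞≈[]prodBelow g-mult (suc N) ℕP.≤-refl) N ℕP.≤-refl)
        (prodBelow-⊗ (suc N) f g N)

-- q-Pochhammer symbols

-- A family h whose products ∏_j h (s + d j) converge q-adically for s, d ≥ 1.
ConvergentFactors : (ℕ → PS) → Set
ConvergentFactors h = ∀ m → h m ≈[ m ] one

convergent-oneMinus : ConvergentFactors oneMinus
convergent-oneMinus m = one-minus≈[]one (q^m∣mono m)

convergent-geomInv : ConvergentFactors geomInv
convergent-geomInv = geomInv≈[]one

progression-index-bound : ∀ s d .{{_ : NonZero d}} j → 1 ≤ s → suc j ≤ s ℕ.+ d ℕ.* j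
progression-index-bound s d j 1≤s = ℕP.+-mono-≤ 1≤s (ℕP.m≤n*m j d)

progression-unfold : ∀ s d j → s ℕ.+ d ℕ.* suc j ≡ (s ℕ.+ d) ℕ.+ d ℕ.* j
progression-unfold = ℕ-Solver.solve-∀

progression-zero : ∀ s d → s ℕ.+ d ℕ.* 0 ≡ s
progression-zero = ℕ-Solver.solve-∀

prodBelow-progression-unfoldˡ : ∀ (h : ℕ → PS) s d n →
  prodBelow (suc n) (λ j → h (s ℕ.+ d ℕ.* j)) ≈ h s ⊗ prodBelow n (λ j → h ((s ℕ.+ d) ℕ.+ d ℕ.* j))
prodBelow-progression-unfoldˡ h s d n =
  ≈-trans (prodBelow-unfoldˡ n (λ j → h (s ℕ.+ d ℕ.* j)))
          (⊗-cong (≡⇒≈ (cong h (progression-zero s d)))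
                  (prodBelow-cong n (λ j → ≡⇒≈ (cong h (progression-unfold s d j)))))

module _ {h : ℕ → PS} (h-convergent : ConvergentFactors h) where

  multipliable-progression : ∀ s d .{{_ : NonZero d}} → 1 ≤ s → Multipliable (λ j → h (s ℕ.+ d ℕ.* j))
  multipliable-progression s d 1≤s j =
    ≈[]-weaken (progression-index-bound s d j 1≤s) (h-convergent (s ℕ.+ d ℕ.* j))

  Π∞-progression≈[]one : ∀ s d → Π∞ (λ j → h (s ℕ.+ d ℕ.* j)) ≈[ s ] one
  Π∞-progression≈[]one s d = Π∞≈[]one (λ j → ≈[]-weaken (ℕP.m≤m+n s (d ℕ.* j)) (h-convergent (s ℕ.+ d ℕ.* j)))

  Π∞-progression-unfoldˡ : ∀ s d .{{_ : NonZero d}} → 1 ≤ s →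
    Π∞ (λ j → h (s ℕ.+ d ℕ.* j)) ≈ h s ⊗ Π∞ (λ j → h ((s ℕ.+ d) ℕ.+ d ℕ.* j))
  Π∞-progression-unfoldˡ s d 1≤s =
    ≈-trans (Π∞-unfoldˡ (multipliable-progression s d 1≤s))
            (⊗-cong (≡⇒≈ (cong h (progression-zero s d)))
                    (Π∞-cong (λ j → ≡⇒≈ (cong h (progression-unfold s d j)))))

  Π∞-progression-split : ∀ n s d .{{_ : NonZero d}} → 1 ≤ s →
    Π∞ (λ j → h (s ℕ.+ d ℕ.* j))
      ≈ prodBelow n (λ j → h (s ℕ.+ d ℕ.* j)) ⊗ Π∞ (λ j → h ((s ℕ.+ d ℕ.* n) ℕ.+ d ℕ.* j))
  Π∞-progression-split zero s d 1≤s =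
    ≈-trans (≈-sym (⊗-identityˡ _))
            (⊗-congʳ one (Π∞-cong (λ j N → cong (λ i → h (i ℕ.+ d ℕ.* j) N) (sym (progression-zero s d)))))
  Π∞-progression-split (suc n) s d 1≤s = begin
    Π∞ (progression s)
      ≈⟨ Π∞-progression-unfoldˡ s d 1≤s ⟩
    h s ⊗ Π∞ (progression (s ℕ.+ d))
      ≈⟨ ⊗-congʳ (h s) (Π∞-progression-split n (s ℕ.+ d) d (ℕP.≤-trans 1≤s (ℕP.m≤m+n s d))) ⟩
    h s ⊗ (prodBelow n (progression (s ℕ.+ d)) ⊗ Π∞ (progression ((s ℕ.+ d) ℕ.+ d ℕ.* n)))
      ≈⟨ ≈-sym (⊗-assoc (h s) (prodBelow n (progression (s ℕ.+ d))) (Π∞ (progression ((s ℕ.+ d) ℕ.+ d ℕ.* n)))) ⟩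
    (h s ⊗ prodBelow n (progression (s ℕ.+ d))) ⊗ Π∞ (progression ((s ℕ.+ d) ℕ.+ d ℕ.* n))
      ≈⟨ ⊗-cong (≈-sym (prodBelow-progression-unfoldˡ h s d n))
                (Π∞-cong (λ j N → cong (λ i → h (i ℕ.+ d ℕ.* j) N) (sym (progression-unfold s d n)))) ⟩
    prodBelow (suc n) (progression s) ⊗ Π∞ (progression (s ℕ.+ d ℕ.* suc n)) ∎
    where
    open ≈-Reasoning
    progression : ℕ → ℕ → PS
    progression s j = h (s ℕ.+ d ℕ.* j)

poch∞-unfoldˡ : ∀ s d .{{_ : NonZero d}} → 1 ≤ s → poch∞ s d ≈ oneMinus s ⊗ poch∞ (s ℕ.+ d) d
poch∞-unfoldˡ = Π∞-progression-unfoldˡ convergent-oneMinus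

poch∞≈[]one : ∀ s d → poch∞ s d ≈[ s ] one
poch∞≈[]one = Π∞-progression≈[]one convergent-oneMinus

geomInv-inverseˡ : ∀ m → 1 ≤ m → oneMinus m ⊗ geomInv m ≈ one
geomInv-inverseˡ m 1≤m = ≈-trans (⊗-comm (oneMinus m) (geomInv m)) (geomInv-inverseʳ m 1≤m)

pochFin-inverse : ∀ s d n → 1 ≤ s → pochFin s d n ⊗ invPochFin s d n ≈ one
pochFin-inverse s d n 1≤s =
  ≈-trans (prodBelow-⊗ n _ _)
          (prodBelow-≈one n (λ j → geomInv-inverseˡ (s ℕ.+ d ℕ.* j) (ℕP.≤-trans 1≤s (ℕP.m≤m+n s _))))

poch∞-inverse : ∀ s d .{{_ : NonZero d}} → 1 ≤ s → poch∞ s d ⊗ invPoch∞ s d ≈ one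
poch∞-inverse s d 1≤s =
  ≈-trans (Π∞-⊗ (multipliable-progression convergent-oneMinus s d 1≤s) (multipliable-progression convergent-geomInv s d 1≤s))
          (Π∞-≈one (λ j → geomInv-inverseˡ (s ℕ.+ d ℕ.* j) (ℕP.≤-trans 1≤s (ℕP.m≤m+n s _))))

poch∞-shift : ∀ n s d .{{_ : NonZero d}} → 1 ≤ s → poch∞ (s ℕ.+ d ℕ.* n) d ≈ invPochFin s d n ⊗ poch∞ s d
poch∞-shift n s d 1≤s =
  unit-cancelˡ (pochFin s d n) (invPochFin s d n) (poch∞ (s ℕ.+ d ℕ.* n) d) (poch∞ s d)
               (pochFin-inverse s d n 1≤s)
               (≈-sym (Π∞-progression-split convergent-oneMinus n s d 1≤s))

invPoch∞-shift : ∀ n s d .{{_ : NonZero d}} → 1 ≤ s → invPoch∞ (s ℕ.+ d ℕ.* n) d ≈ pochFin s d n ⊗ invPoch∞ s d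
invPoch∞-shift n s d 1≤s =
  unit-cancelˡ (invPochFin s d n) (pochFin s d n) (invPoch∞ (s ℕ.+ d ℕ.* n) d) (invPoch∞ s d)
               (≈-trans (⊗-comm (invPochFin s d n) (pochFin s d n)) (pochFin-inverse s d n 1≤s))
               (≈-sym (Π∞-progression-split convergent-geomInv n s d 1≤s))

-- Uniqueness of solutions of q-recursions

-- Each step of the recursion raises the q-adic order of the difference of two solutions by d ≥ 1.
recursion-unique : ∀ (X Y β : ℕ → PS) d .{{_ : NonZero d}} →
  (∀ s → 1 ≤ s → X s ≈ β s ⊗ X (s ℕ.+ d)) → (∀ s → 1 ≤ s → Y s ≈ β s ⊗ Y (s ℕ.+ d)) →
  (∀ s → 1 ≤ s → X s ≈[ s ] Y s) → ∀ s → 1 ≤ s → X s ≈ Y s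
recursion-unique X Y β d X-rec Y-rec X≈[]Y s 1≤s N =
  ∣-diff⇒≈[] {f = X s} {Y s} (divisible N s 1≤s) N (ℕP.m<m+n N 1≤s)
  where
  factor : ∀ b x y → (b ⊗ x) ⊕ ⊖ (b ⊗ y) ≈ b ⊗ (x ⊕ ⊖ y)
  factor = solve 3 (λ b x y → (b :* x) :- (b :* y) := b :* (x :- y)) ≈-refl
  divisible : ∀ K s → 1 ≤ s → q^ (K ℕ.+ s) ∣ X s ⊕ ⊖ Y s
  divisible zero    s 1≤s = ≈[]⇒∣-diff (X≈[]Y s 1≤s)
  divisible (suc K) s 1≤s =
    ∣-cong (≈-trans (≈-sym (factor (β s) (X (s ℕ.+ d)) (Y (s ℕ.+ d))))
                    (≈-sym (⊕-cong (X-rec s 1≤s) (⊖-cong (Y-rec s 1≤s)))))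
      (∣-⊗ˡ (β s) (≈[]-weaken K+s<K+s+d (divisible K (s ℕ.+ d) (ℕP.≤-trans 1≤s (ℕP.m≤m+n s d)))))
    where
    K+s<K+s+d : suc K ℕ.+ s ≤ K ℕ.+ (s ℕ.+ d)
    K+s<K+s+d = ℕP.≤-trans (ℕP.≤-reflexive (ℕP.+-comm 1 (K ℕ.+ s)))
      (ℕP.≤-trans (ℕP.+-monoʳ-≤ (K ℕ.+ s) (ℕ.>-nonZero⁻¹ d)) (ℕP.≤-reflexive (ℕP.+-assoc K s d)))

-- The right-hand side is a q-adic contraction: it raises the order of the difference of two solutions.
contraction-unique : ∀ (X Y c : ℕ → PS) d →
  (∀ j → 1 ≤ j → X j ≈ c j ⊕ mono j ⊗ X j ⊕ mono 1 ⊗ X (j ℕ.+ d)) →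
  (∀ j → 1 ≤ j → Y j ≈ c j ⊕ mono j ⊗ Y j ⊕ mono 1 ⊗ Y (j ℕ.+ d)) →
  ∀ j → 1 ≤ j → X j ≈ Y j
contraction-unique X Y c d X-rec Y-rec j 1≤j N = ∣-diff⇒≈[] {f = X j} {Y j} (divisible (suc N) j 1≤j) N ℕP.≤-refl
  where
  difference : ∀ c x y x′ y′ t u →
    (c ⊕ t ⊗ x ⊕ u ⊗ x′) ⊕ ⊖ (c ⊕ t ⊗ y ⊕ u ⊗ y′) ≈ t ⊗ (x ⊕ ⊖ y) ⊕ u ⊗ (x′ ⊕ ⊖ y′)
  difference = solve 7 (λ c x y x′ y′ t u →
    (c :+ t :* x :+ u :* x′) :- (c :+ t :* y :+ u :* y′) := t :* (x :- y) :+ u :* (x′ :- y′)) ≈-refl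
  divisible : ∀ K j → 1 ≤ j → q^ K ∣ X j ⊕ ⊖ Y j
  divisible zero    j 1≤j = λ _ ()
  divisible (suc K) j 1≤j =
    ∣-cong (≈-sym (≈-trans (⊕-cong (X-rec j 1≤j) (⊖-cong (Y-rec j 1≤j)))
                           (difference (c j) (X j) (Y j) (X (j ℕ.+ d)) (Y (j ℕ.+ d)) (mono j) (mono 1))))
      (∣-⊕ (≈[]-weaken (ℕP.+-monoˡ-≤ K 1≤j) (∣-⊗ (q^m∣mono j) (divisible K j 1≤j)))
           (∣-⊗ (q^m∣mono 1) (divisible K (j ℕ.+ d) (ℕP.≤-trans 1≤j (ℕP.m≤m+n j d)))))

-- The q-binomial theorem

oneMinus[_] : PS → ℕ → PS
oneMinus[ a ] m = one ⊕ ⊖ (a ⊗ mono m)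

convergent-oneMinus[] : ∀ a → ConvergentFactors oneMinus[ a ]
convergent-oneMinus[] a m = one-minus≈[]one (∣-⊗ˡ a (q^m∣mono m))

oneMinus[𝟘] : ∀ m → oneMinus[ 𝟘 ] m ≈ one
oneMinus[𝟘] m N =
  trans (cong (λ x → one N + - x) (sumBelow-zero (suc N) (λ _ _ → refl))) (ℤP.+-identityʳ (one N))

oneMinus[mono] : ∀ c m → oneMinus[ mono c ] m ≈ oneMinus (c ℕ.+ m)
oneMinus[mono] c m = ⊕-congʳ one (⊖-cong (mono-+ c m))

n≤s*n : ∀ {s} n → 1 ≤ s → n ≤ s ℕ.* n
n≤s*n n (s≤s z≤n) = ℕP.m≤m+n n _

module q-Binomial (a : PS) (d : ℕ) .{{_ : NonZero d}} where

  coefficient : ℕ → PS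
  coefficient n = prodBelow n (λ i → oneMinus[ a ] (d ℕ.* i)) ⊗ invPochFin d d n

  term : ℕ → ℕ → PS
  term s n = mono (s ℕ.* n) ⊗ coefficient n

  Φ : ℕ → PS
  Φ s = Σ∞ (term s)

  aPoch∞ : ℕ → PS
  aPoch∞ s = Π∞ (λ j → oneMinus[ a ] (s ℕ.+ d ℕ.* j))

  term-summable : ∀ s → 1 ≤ s → Summable (term s)
  term-summable s 1≤s = summable-mono⊗ (s ℕ.*_) coefficient (λ n → n≤s*n n 1≤s)

  term-zero : ∀ s → term s 0 ≈ one
  term-zero s N =
    trans (⊗-congˡ (one ⊗ one) (≈-trans (mono-cong (ℕP.*-zeroʳ s)) mono-zero) N)
          (trans (⊗-identityˡ (one ⊗ one) N) (⊗-identityˡ one N))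

  coefficient-rec : ∀ n → coefficient (suc n) ⊗ oneMinus (d ℕ.+ d ℕ.* n) ≈ coefficient n ⊗ oneMinus[ a ] (d ℕ.* n)
  coefficient-rec n = begin
    ((A ⊗ α) ⊗ (B ⊗ g)) ⊗ oneMinus (d ℕ.+ d ℕ.* n)
      ≈⟨ regroup A α B g (oneMinus (d ℕ.+ d ℕ.* n)) ⟩
    ((A ⊗ B) ⊗ α) ⊗ (g ⊗ oneMinus (d ℕ.+ d ℕ.* n))
      ≈⟨ ⊗-congʳ ((A ⊗ B) ⊗ α) (geomInv-inverseʳ (d ℕ.+ d ℕ.* n) 1≤d+dn) ⟩
    ((A ⊗ B) ⊗ α) ⊗ one
      ≈⟨ ⊗-identityʳ ((A ⊗ B) ⊗ α) ⟩
    (A ⊗ B) ⊗ α ∎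
    where
    open ≈-Reasoning
    A = prodBelow n (λ i → oneMinus[ a ] (d ℕ.* i))
    B = invPochFin d d n
    α = oneMinus[ a ] (d ℕ.* n)
    g = geomInv (d ℕ.+ d ℕ.* n)
    1≤d+dn : 1 ≤ d ℕ.+ d ℕ.* n
    1≤d+dn = ℕP.≤-trans (ℕ.>-nonZero⁻¹ d) (ℕP.m≤m+n d (d ℕ.* n))
    regroup : ∀ A α B g o → ((A ⊗ α) ⊗ (B ⊗ g)) ⊗ o ≈ ((A ⊗ B) ⊗ α) ⊗ (g ⊗ o)
    regroup = solve 5 (λ A α B g o → ((A :* α) :* (B :* g)) :* o := ((A :* B) :* α) :* (g :* o)) ≈-refl

  term-difference-zero : ∀ s → term s 0 ⊕ ⊖ term (s ℕ.+ d) 0 ≈ 𝟘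
  term-difference-zero s N =
    trans (cong₂ (λ x y → x + - y) (term-zero s N) (term-zero (s ℕ.+ d) N)) (ℤP.+-inverseʳ (one N))

  term-difference-suc : ∀ s m → term s (suc m) ⊕ ⊖ term (s ℕ.+ d) (suc m)
                              ≈ mono s ⊗ term s m ⊕ ⊖ ((a ⊗ mono s) ⊗ term (s ℕ.+ d) m)
  term-difference-suc s m = begin
    mono (s ℕ.* suc m) ⊗ C ⊕ ⊖ (mono ((s ℕ.+ d) ℕ.* suc m) ⊗ C)
      ≈⟨ ⊕-cong (⊗-congˡ C (mono-split s (s ℕ.* m) (sym (ℕP.*-suc s m))))
                (⊖-cong (⊗-congˡ C (≈-trans (mono-split (s ℕ.+ s ℕ.* m) (d ℕ.+ d ℕ.* m) (exponent s d m))
                                            (⊗-congˡ W (mono-split s (s ℕ.* m) refl))))) ⟩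
    (X ⊗ Y) ⊗ C ⊕ ⊖ (((X ⊗ Y) ⊗ W) ⊗ C)
      ≈⟨ factor-out X Y C W ⟩
    (X ⊗ Y) ⊗ (C ⊗ oneMinus (d ℕ.+ d ℕ.* m))
      ≈⟨ ⊗-congʳ (X ⊗ Y) (coefficient-rec m) ⟩
    (X ⊗ Y) ⊗ (c ⊗ (one ⊕ ⊖ (a ⊗ Z)))
      ≈⟨ expand X Y c a Z ⟩
    X ⊗ (Y ⊗ c) ⊕ ⊖ ((a ⊗ X) ⊗ ((Y ⊗ Z) ⊗ c))
      ≈⟨ ⊕-congʳ (X ⊗ (Y ⊗ c))
           (⊖-cong (⊗-congʳ (a ⊗ X) (⊗-congˡ c (≈-sym (mono-split (s ℕ.* m) (d ℕ.* m) (sym (ℕP.*-distribʳ-+ m s d))))))) ⟩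
    X ⊗ term s m ⊕ ⊖ ((a ⊗ X) ⊗ term (s ℕ.+ d) m) ∎
    where
    open ≈-Reasoning
    X = mono s
    Y = mono (s ℕ.* m)
    Z = mono (d ℕ.* m)
    W = mono (d ℕ.+ d ℕ.* m)
    C = coefficient (suc m)
    c = coefficient m
    exponent : ∀ s d m → (s ℕ.+ s ℕ.* m) ℕ.+ (d ℕ.+ d ℕ.* m) ≡ (s ℕ.+ d) ℕ.* suc m
    exponent = ℕ-Solver.solve-∀
    factor-out : ∀ X Y C W → (X ⊗ Y) ⊗ C ⊕ ⊖ (((X ⊗ Y) ⊗ W) ⊗ C) ≈ (X ⊗ Y) ⊗ (C ⊗ (one ⊕ ⊖ W))
    factor-out = solve 4 (λ X Y C W → (X :* Y) :* C :- ((X :* Y) :* W) :* C := (X :* Y) :* (C :* (con 1ℤ :- W))) ≈-refl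
    expand : ∀ X Y c a Z → (X ⊗ Y) ⊗ (c ⊗ (one ⊕ ⊖ (a ⊗ Z))) ≈ X ⊗ (Y ⊗ c) ⊕ ⊖ ((a ⊗ X) ⊗ ((Y ⊗ Z) ⊗ c))
    expand = solve 5 (λ X Y c a Z → (X :* Y) :* (c :* (con 1ℤ :- a :* Z)) := X :* (Y :* c) :- (a :* X) :* ((Y :* Z) :* c)) ≈-refl

  difference-summable : ∀ s → 1 ≤ s → Summable (λ n → term s n ⊕ ⊖ term (s ℕ.+ d) n)
  difference-summable s 1≤s n =
    ∣-⊕ (term-summable s 1≤s n) (∣-⊖ (term-summable (s ℕ.+ d) (ℕP.≤-trans 1≤s (ℕP.m≤m+n s d)) n))

  Φ-difference : ∀ s → 1 ≤ s → Φ s ⊕ ⊖ Φ (s ℕ.+ d) ≈ mono s ⊗ Φ s ⊕ ⊖ ((a ⊗ mono s) ⊗ Φ (s ℕ.+ d))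
  Φ-difference s 1≤s = begin
    Φ s ⊕ ⊖ Φ (s ℕ.+ d)
      ≈⟨ ≈-sym (Σ∞-difference (term s) (term (s ℕ.+ d))) ⟩
    Σ∞ (λ n → term s n ⊕ ⊖ term (s ℕ.+ d) n)
      ≈⟨ Σ∞-unfoldˡ (difference-summable s 1≤s) ⟩
    (term s 0 ⊕ ⊖ term (s ℕ.+ d) 0) ⊕ Σ∞ (λ m → term s (suc m) ⊕ ⊖ term (s ℕ.+ d) (suc m))
      ≈⟨ ⊕-cong (term-difference-zero s) (Σ∞-cong (term-difference-suc s)) ⟩
    𝟘 ⊕ Σ∞ (λ m → mono s ⊗ term s m ⊕ ⊖ ((a ⊗ mono s) ⊗ term (s ℕ.+ d) m))
      ≈⟨ (λ N → ℤP.+-identityˡ _) ⟩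
    Σ∞ (λ m → mono s ⊗ term s m ⊕ ⊖ ((a ⊗ mono s) ⊗ term (s ℕ.+ d) m))
      ≈⟨ Σ∞-difference (λ m → mono s ⊗ term s m) (λ m → (a ⊗ mono s) ⊗ term (s ℕ.+ d) m) ⟩
    Σ∞ (λ m → mono s ⊗ term s m) ⊕ ⊖ Σ∞ (λ m → (a ⊗ mono s) ⊗ term (s ℕ.+ d) m)
      ≈⟨ ⊕-cong (≈-sym (⊗-Σ∞ (mono s) (term-summable s 1≤s)))
                (⊖-cong (≈-sym (⊗-Σ∞ (a ⊗ mono s) (term-summable (s ℕ.+ d) (ℕP.≤-trans 1≤s (ℕP.m≤m+n s d)))))) ⟩
    mono s ⊗ Φ s ⊕ ⊖ ((a ⊗ mono s) ⊗ Φ (s ℕ.+ d)) ∎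
    where open ≈-Reasoning

  Φ-rec : ∀ s → 1 ≤ s → Φ s ⊗ oneMinus s ≈ Φ (s ℕ.+ d) ⊗ oneMinus[ a ] s
  Φ-rec s 1≤s = begin
    Φ s ⊗ (one ⊕ ⊖ mono s)
      ≈⟨ expand (Φ s) (mono s) ⟩
    Φ s ⊕ ⊖ (mono s ⊗ Φ s)
      ≈⟨ difference-swap (Φ s) (Φ (s ℕ.+ d)) (mono s ⊗ Φ s) ((a ⊗ mono s) ⊗ Φ (s ℕ.+ d)) (Φ-difference s 1≤s) ⟩
    Φ (s ℕ.+ d) ⊕ ⊖ ((a ⊗ mono s) ⊗ Φ (s ℕ.+ d))
      ≈⟨ factor (Φ (s ℕ.+ d)) (a ⊗ mono s) ⟩
    Φ (s ℕ.+ d) ⊗ (one ⊕ ⊖ (a ⊗ mono s)) ∎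
    where
    open ≈-Reasoning
    expand : ∀ F x → F ⊗ (one ⊕ ⊖ x) ≈ F ⊕ ⊖ (x ⊗ F)
    expand = solve 2 (λ F x → F :* (con 1ℤ :- x) := F :- x :* F) ≈-refl
    factor : ∀ F x → F ⊕ ⊖ (x ⊗ F) ≈ F ⊗ (one ⊕ ⊖ x)
    factor F x = ≈-sym (expand F x)

  Φ≈[]one : ∀ s → 1 ≤ s → Φ s ≈[ s ] one
  Φ≈[]one s 1≤s N N<s =
    trans (Σ∞-unfoldˡ (term-summable s 1≤s) N)
          (trans (cong₂ _+_ (term-zero s N) (∣-Σ∞ higher-terms-divisible N N<s)) (ℤP.+-identityʳ (one N)))
    where
    higher-terms-divisible : ∀ n → q^ s ∣ term s (suc n)
    higher-terms-divisible n = ≈[]-weaken (ℕP.m≤m*n s (suc n)) (q^a∣mono⊗ (s ℕ.* suc n) (coefficient (suc n)))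

  Φ⊗poch∞ : ∀ s → 1 ≤ s → Φ s ⊗ poch∞ s d ≈ aPoch∞ s
  Φ⊗poch∞ = recursion-unique (λ s → Φ s ⊗ poch∞ s d) aPoch∞ oneMinus[ a ] d
    Φ⊗poch∞-rec (λ s → Π∞-progression-unfoldˡ (convergent-oneMinus[] a) s d) same-residue
    where
    same-residue : ∀ s → 1 ≤ s → Φ s ⊗ poch∞ s d ≈[ s ] aPoch∞ s
    same-residue s 1≤s =
      ≈[]-trans (≈[]-trans (≈[]-⊗ (Φ≈[]one s 1≤s) (poch∞≈[]one s d)) (≈⇒≈[] (⊗-identityˡ one)))
                (≈[]-sym (Π∞-progression≈[]one (convergent-oneMinus[] a) s d))
    Φ⊗poch∞-rec : ∀ s → 1 ≤ s → Φ s ⊗ poch∞ s d ≈ oneMinus[ a ] s ⊗ (Φ (s ℕ.+ d) ⊗ poch∞ (s ℕ.+ d) d)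
    Φ⊗poch∞-rec s 1≤s = begin
      Φ s ⊗ poch∞ s d                                  ≈⟨ ⊗-congʳ (Φ s) (poch∞-unfoldˡ s d 1≤s) ⟩
      Φ s ⊗ (oneMinus s ⊗ poch∞ (s ℕ.+ d) d)            ≈⟨ ≈-sym (⊗-assoc (Φ s) (oneMinus s) (poch∞ (s ℕ.+ d) d)) ⟩
      (Φ s ⊗ oneMinus s) ⊗ poch∞ (s ℕ.+ d) d            ≈⟨ ⊗-congˡ (poch∞ (s ℕ.+ d) d) (Φ-rec s 1≤s) ⟩
      (Φ (s ℕ.+ d) ⊗ oneMinus[ a ] s) ⊗ poch∞ (s ℕ.+ d) d
        ≈⟨ rotate (Φ (s ℕ.+ d)) (oneMinus[ a ] s) (poch∞ (s ℕ.+ d) d) ⟩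
      oneMinus[ a ] s ⊗ (Φ (s ℕ.+ d) ⊗ poch∞ (s ℕ.+ d) d) ∎
      where
      open ≈-Reasoning
      rotate : ∀ F b P → (F ⊗ b) ⊗ P ≈ b ⊗ (F ⊗ P)
      rotate = solve 3 (λ F b P → (F :* b) :* P := b :* (F :* P)) ≈-refl

  q-binomial : ∀ s → 1 ≤ s → Φ s ≈ aPoch∞ s ⊗ invPoch∞ s d
  q-binomial s 1≤s = begin
    Φ s                                  ≈⟨ ≈-sym (⊗-identityʳ (Φ s)) ⟩
    Φ s ⊗ one                            ≈⟨ ⊗-congʳ (Φ s) (≈-sym (poch∞-inverse s d 1≤s)) ⟩
    Φ s ⊗ (poch∞ s d ⊗ invPoch∞ s d)     ≈⟨ ≈-sym (⊗-assoc (Φ s) (poch∞ s d) (invPoch∞ s d)) ⟩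
    (Φ s ⊗ poch∞ s d) ⊗ invPoch∞ s d     ≈⟨ ⊗-congˡ (invPoch∞ s d) (Φ⊗poch∞ s 1≤s) ⟩
    aPoch∞ s ⊗ invPoch∞ s d              ∎
    where open ≈-Reasoning

invPoch∞-euler : ∀ s d .{{_ : NonZero d}} → 1 ≤ s → invPoch∞ s d ≈ Σ∞ (λ n → mono (s ℕ.* n) ⊗ invPochFin d d n)
invPoch∞-euler s d 1≤s = begin
  invPoch∞ s d                                  ≈⟨ ≈-sym (⊗-identityˡ (invPoch∞ s d)) ⟩
  one ⊗ invPoch∞ s d
    ≈⟨ ⊗-congˡ (invPoch∞ s d) (≈-sym (Π∞-≈one (λ j → oneMinus[𝟘] (s ℕ.+ d ℕ.* j)))) ⟩
  q-Binomial.aPoch∞ 𝟘 d s ⊗ invPoch∞ s d        ≈⟨ ≈-sym (q-Binomial.q-binomial 𝟘 d s 1≤s) ⟩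
  q-Binomial.Φ 𝟘 d s                            ≈⟨ Σ∞-cong (λ n → ⊗-congʳ (mono (s ℕ.* n)) (coefficient≈ n)) ⟩
  Σ∞ (λ n → mono (s ℕ.* n) ⊗ invPochFin d d n)  ∎
  where
  open ≈-Reasoning
  coefficient≈ : ∀ n → q-Binomial.coefficient 𝟘 d n ≈ invPochFin d d n
  coefficient≈ n = ≈-trans (⊗-congˡ (invPochFin d d n) (prodBelow-≈one n (λ i → oneMinus[𝟘] (d ℕ.* i))))
                           (⊗-identityˡ (invPochFin d d n))

q-binomial-mono : ∀ c s d .{{_ : NonZero d}} → 1 ≤ s →
  Σ∞ (λ n → mono (s ℕ.* n) ⊗ (pochFin c d n ⊗ invPochFin d d n)) ≈ poch∞ (s ℕ.+ c) d ⊗ invPoch∞ s d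
q-binomial-mono c s d 1≤s = begin
  Σ∞ (λ n → mono (s ℕ.* n) ⊗ (pochFin c d n ⊗ invPochFin d d n))
    ≈⟨ Σ∞-cong (λ n → ⊗-congʳ (mono (s ℕ.* n))
         (⊗-congˡ (invPochFin d d n) (prodBelow-cong n (λ i → ≈-sym (oneMinus[mono] c (d ℕ.* i)))))) ⟩
  q-Binomial.Φ (mono c) d s
    ≈⟨ q-Binomial.q-binomial (mono c) d s 1≤s ⟩
  q-Binomial.aPoch∞ (mono c) d s ⊗ invPoch∞ s d
    ≈⟨ ⊗-congˡ (invPoch∞ s d) (Π∞-cong (λ j →
         ≈-trans (oneMinus[mono] c (s ℕ.+ d ℕ.* j)) (≡⇒≈ (cong oneMinus (exponent c s d j))))) ⟩
  poch∞ (s ℕ.+ c) d ⊗ invPoch∞ s d ∎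
  where
  open ≈-Reasoning
  exponent : ∀ c s d j → c ℕ.+ (s ℕ.+ d ℕ.* j) ≡ (s ℕ.+ c) ℕ.+ d ℕ.* j
  exponent = ℕ-Solver.solve-∀

poch∞-shift/poch∞ : ∀ n s d .{{_ : NonZero d}} → 1 ≤ s → poch∞ (s ℕ.+ d ℕ.* n) d ⊗ invPoch∞ s d ≈ invPochFin s d n
poch∞-shift/poch∞ n s d 1≤s = begin
  poch∞ (s ℕ.+ d ℕ.* n) d ⊗ invPoch∞ s d        ≈⟨ ⊗-congˡ (invPoch∞ s d) (poch∞-shift n s d 1≤s) ⟩
  (invPochFin s d n ⊗ poch∞ s d) ⊗ invPoch∞ s d  ≈⟨ ⊗-assoc (invPochFin s d n) (poch∞ s d) (invPoch∞ s d) ⟩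
  invPochFin s d n ⊗ (poch∞ s d ⊗ invPoch∞ s d)  ≈⟨ ⊗-congʳ (invPochFin s d n) (poch∞-inverse s d 1≤s) ⟩
  invPochFin s d n ⊗ one                         ≈⟨ ⊗-identityʳ (invPochFin s d n) ⟩
  invPochFin s d n                               ∎
  where open ≈-Reasoning

poch∞/poch∞-shift : ∀ n s d .{{_ : NonZero d}} → 1 ≤ s → poch∞ s d ⊗ invPoch∞ (s ℕ.+ d ℕ.* n) d ≈ pochFin s d n
poch∞/poch∞-shift n s d 1≤s = begin
  poch∞ s d ⊗ invPoch∞ (s ℕ.+ d ℕ.* n) d      ≈⟨ ⊗-congʳ (poch∞ s d) (invPoch∞-shift n s d 1≤s) ⟩
  poch∞ s d ⊗ (pochFin s d n ⊗ invPoch∞ s d)  ≈⟨ swap (poch∞ s d) (pochFin s d n) (invPoch∞ s d) ⟩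
  pochFin s d n ⊗ (poch∞ s d ⊗ invPoch∞ s d)  ≈⟨ ⊗-congʳ (pochFin s d n) (poch∞-inverse s d 1≤s) ⟩
  pochFin s d n ⊗ one                         ≈⟨ ⊗-identityʳ (pochFin s d n) ⟩
  pochFin s d n                               ∎
  where
  open ≈-Reasoning
  swap : ∀ a b c → a ⊗ (b ⊗ c) ≈ b ⊗ (a ⊗ c)
  swap = solve 3 (λ a b c → a :* (b :* c) := b :* (a :* c)) ≈-refl

-- The series U j and V j

Uterm : ℕ → ℕ → PS
Uterm j n = mono (j ℕ.* n) ⊗ invPochFin 1 2 (suc n)

U : ℕ → PS
U j = Σ∞ (Uterm j)

Uterm-summable : ∀ j → 1 ≤ j → Summable (Uterm j)
Uterm-summable j 1≤j = summable-mono⊗ (j ℕ.*_) (λ n → invPochFin 1 2 (suc n)) (λ n → n≤s*n n 1≤j)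

Uterm-difference : ∀ j n → Uterm j n ⊕ ⊖ (mono 1 ⊗ Uterm (j ℕ.+ 2) n) ≈ mono (j ℕ.* n) ⊗ invPochFin 1 2 n
Uterm-difference j n = begin
  X ⊗ (A ⊗ g) ⊕ ⊖ (mono 1 ⊗ (mono ((j ℕ.+ 2) ℕ.* n) ⊗ (A ⊗ g)))
    ≈⟨ ⊕-congʳ (X ⊗ (A ⊗ g)) (⊖-cong (≈-trans (≈-sym (⊗-assoc (mono 1) (mono ((j ℕ.+ 2) ℕ.* n)) (A ⊗ g)))
         (⊗-congˡ (A ⊗ g) (≈-trans (mono-+ 1 ((j ℕ.+ 2) ℕ.* n)) (mono-split (j ℕ.* n) (1 ℕ.+ 2 ℕ.* n) (sym (exponent j n))))))) ⟩
  X ⊗ (A ⊗ g) ⊕ ⊖ ((X ⊗ mono (1 ℕ.+ 2 ℕ.* n)) ⊗ (A ⊗ g))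
    ≈⟨ factor-out X A g (mono (1 ℕ.+ 2 ℕ.* n)) ⟩
  X ⊗ (A ⊗ (g ⊗ oneMinus (1 ℕ.+ 2 ℕ.* n)))
    ≈⟨ ⊗-congʳ X (⊗-congʳ A (geomInv-inverseʳ (1 ℕ.+ 2 ℕ.* n) (s≤s z≤n))) ⟩
  X ⊗ (A ⊗ one)
    ≈⟨ ⊗-congʳ X (⊗-identityʳ A) ⟩
  X ⊗ A ∎
  where
  open ≈-Reasoning
  X = mono (j ℕ.* n)
  A = invPochFin 1 2 n
  g = geomInv (1 ℕ.+ 2 ℕ.* n)
  exponent : ∀ j n → 1 ℕ.+ (j ℕ.+ 2) ℕ.* n ≡ j ℕ.* n ℕ.+ (1 ℕ.+ 2 ℕ.* n)
  exponent = ℕ-Solver.solve-∀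
  factor-out : ∀ X A g t → X ⊗ (A ⊗ g) ⊕ ⊖ ((X ⊗ t) ⊗ (A ⊗ g)) ≈ X ⊗ (A ⊗ (g ⊗ (one ⊕ ⊖ t)))
  factor-out = solve 4 (λ X A g t → X :* (A :* g) :- (X :* t) :* (A :* g) := X :* (A :* (g :* (con 1ℤ :- t)))) ≈-refl

Σ∞-mono⊗invPochFin : ∀ j → 1 ≤ j → Σ∞ (λ n → mono (j ℕ.* n) ⊗ invPochFin 1 2 n) ≈ one ⊕ mono j ⊗ U j
Σ∞-mono⊗invPochFin j 1≤j = begin
  Σ∞ (λ n → mono (j ℕ.* n) ⊗ invPochFin 1 2 n)
    ≈⟨ Σ∞-unfoldˡ (summable-mono⊗ (j ℕ.*_) (invPochFin 1 2) (λ n → n≤s*n n 1≤j)) ⟩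
  mono (j ℕ.* 0) ⊗ one ⊕ Σ∞ (λ n → mono (j ℕ.* suc n) ⊗ invPochFin 1 2 (suc n))
    ≈⟨ ⊕-cong (≈-trans (⊗-congˡ one (≈-trans (mono-cong (ℕP.*-zeroʳ j)) mono-zero)) (⊗-identityˡ one))
              (Σ∞-cong (λ n → ≈-trans (⊗-congˡ (invPochFin 1 2 (suc n)) (mono-split j (j ℕ.* n) (sym (ℕP.*-suc j n))))
                                     (⊗-assoc (mono j) (mono (j ℕ.* n)) (invPochFin 1 2 (suc n))))) ⟩
  one ⊕ Σ∞ (λ n → mono j ⊗ Uterm j n)
    ≈⟨ ⊕-congʳ one (≈-sym (⊗-Σ∞ (mono j) (Uterm-summable j 1≤j))) ⟩
  one ⊕ mono j ⊗ U j ∎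
  where open ≈-Reasoning

U-rec : ∀ j → 1 ≤ j → U j ≈ one ⊕ mono j ⊗ U j ⊕ mono 1 ⊗ U (j ℕ.+ 2)
U-rec j 1≤j = begin
  U j
    ≈⟨ add-and-subtract (U j) (mono 1 ⊗ U (j ℕ.+ 2)) ⟩
  (U j ⊕ ⊖ (mono 1 ⊗ U (j ℕ.+ 2))) ⊕ mono 1 ⊗ U (j ℕ.+ 2)
    ≈⟨ ⊕-cong difference (≈-refl {mono 1 ⊗ U (j ℕ.+ 2)}) ⟩
  one ⊕ mono j ⊗ U j ⊕ mono 1 ⊗ U (j ℕ.+ 2) ∎
  where
  open ≈-Reasoning
  add-and-subtract : ∀ X Y → X ≈ (X ⊕ ⊖ Y) ⊕ Y
  add-and-subtract = solve 2 (λ X Y → X := (X :- Y) :+ Y) ≈-refl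
  difference : U j ⊕ ⊖ (mono 1 ⊗ U (j ℕ.+ 2)) ≈ one ⊕ mono j ⊗ U j
  difference = begin
    U j ⊕ ⊖ (mono 1 ⊗ U (j ℕ.+ 2))
      ≈⟨ ⊕-congʳ (U j) (⊖-cong (⊗-Σ∞ (mono 1) (Uterm-summable (j ℕ.+ 2) (ℕP.≤-trans 1≤j (ℕP.m≤m+n j 2))))) ⟩
    U j ⊕ ⊖ Σ∞ (λ n → mono 1 ⊗ Uterm (j ℕ.+ 2) n)
      ≈⟨ ≈-sym (Σ∞-difference (Uterm j) (λ n → mono 1 ⊗ Uterm (j ℕ.+ 2) n)) ⟩
    Σ∞ (λ n → Uterm j n ⊕ ⊖ (mono 1 ⊗ Uterm (j ℕ.+ 2) n))
      ≈⟨ Σ∞-cong (Uterm-difference j) ⟩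
    Σ∞ (λ n → mono (j ℕ.* n) ⊗ invPochFin 1 2 n)
      ≈⟨ Σ∞-mono⊗invPochFin j 1≤j ⟩
    one ⊕ mono j ⊗ U j ∎

Vexponent : ℕ → ℕ → ℕ
Vexponent j n = j ℕ.* n ℕ.+ 2 ℕ.* n ℕ.* n ℕ.+ n

Vterm : ℕ → ℕ → PS
Vterm j n = mono (Vexponent j n) ⊗ (invPochFin 1 2 (suc n) ⊗ invPochFin j 2 (suc n))

V : ℕ → PS
V j = Σ∞ (Vterm j)

Vtelescope : ℕ → ℕ → PS
Vtelescope j n = mono (Vexponent j n) ⊗ (invPochFin 1 2 n ⊗ invPochFin (j ℕ.+ 2) 2 n)

n≤Vexponent : ∀ j n → n ≤ Vexponent j n
n≤Vexponent j n = ℕP.m≤n+m n (j ℕ.* n ℕ.+ 2 ℕ.* n ℕ.* n)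

Vterm-summable : ∀ j → Summable (Vterm j)
Vterm-summable j = summable-mono⊗ (Vexponent j) (λ n → invPochFin 1 2 (suc n) ⊗ invPochFin j 2 (suc n)) (n≤Vexponent j)

Vtelescope-summable : ∀ j → Summable (Vtelescope j)
Vtelescope-summable j = summable-mono⊗ (Vexponent j) (λ n → invPochFin 1 2 n ⊗ invPochFin (j ℕ.+ 2) 2 n) (n≤Vexponent j)

Vexponent-+2 : ∀ j n → 1 ℕ.+ ((j ℕ.+ 2) ℕ.* n ℕ.+ 2 ℕ.* n ℕ.* n ℕ.+ n)
                     ≡ (j ℕ.* n ℕ.+ 2 ℕ.* n ℕ.* n ℕ.+ n) ℕ.+ (1 ℕ.+ 2 ℕ.* n)
Vexponent-+2 = ℕ-Solver.solve-∀

Vexponent-suc : ∀ j n → (j ℕ.* n ℕ.+ 2 ℕ.* n ℕ.* n ℕ.+ n) ℕ.+ ((1 ℕ.+ 2 ℕ.* n) ℕ.+ ((j ℕ.+ 2) ℕ.+ 2 ℕ.* n))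
                      ≡ j ℕ.* suc n ℕ.+ 2 ℕ.* suc n ℕ.* suc n ℕ.+ suc n
Vexponent-suc = ℕ-Solver.solve-∀

module _ (j n : ℕ) where
  private
    x  = mono (Vexponent j n)
    A  = invPochFin 1 2 n
    B  = invPochFin (j ℕ.+ 2) 2 n
    g₁ = geomInv (1 ℕ.+ 2 ℕ.* n)
    t₁ = mono (1 ℕ.+ 2 ℕ.* n)
    gB = geomInv ((j ℕ.+ 2) ℕ.+ 2 ℕ.* n)
    tB = mono ((j ℕ.+ 2) ℕ.+ 2 ℕ.* n)

  oneMinus⊗Vterm : 1 ≤ j → oneMinus j ⊗ Vterm j n ≈ Vtelescope j n ⊗ g₁
  oneMinus⊗Vterm 1≤j = begin
    oneMinus j ⊗ (x ⊗ ((A ⊗ g₁) ⊗ invPochFin j 2 (suc n)))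
      ≈⟨ ⊗-congʳ (oneMinus j) (⊗-congʳ x (⊗-congʳ (A ⊗ g₁) (prodBelow-progression-unfoldˡ geomInv j 2 n))) ⟩
    oneMinus j ⊗ (x ⊗ ((A ⊗ g₁) ⊗ (geomInv j ⊗ B)))
      ≈⟨ regroup (oneMinus j) x A g₁ (geomInv j) B ⟩
    (oneMinus j ⊗ geomInv j) ⊗ ((x ⊗ (A ⊗ B)) ⊗ g₁)
      ≈⟨ ⊗-congˡ ((x ⊗ (A ⊗ B)) ⊗ g₁) (geomInv-inverseˡ j 1≤j) ⟩
    one ⊗ ((x ⊗ (A ⊗ B)) ⊗ g₁)
      ≈⟨ ⊗-identityˡ ((x ⊗ (A ⊗ B)) ⊗ g₁) ⟩
    (x ⊗ (A ⊗ B)) ⊗ g₁ ∎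
    where
    open ≈-Reasoning
    regroup : ∀ o x A g₁ g B → o ⊗ (x ⊗ ((A ⊗ g₁) ⊗ (g ⊗ B))) ≈ (o ⊗ g) ⊗ ((x ⊗ (A ⊗ B)) ⊗ g₁)
    regroup = solve 6 (λ o x A g₁ g B → o :* (x :* ((A :* g₁) :* (g :* B))) := (o :* g) :* ((x :* (A :* B)) :* g₁)) ≈-refl

  q⊗Vterm : mono 1 ⊗ Vterm (j ℕ.+ 2) n ≈ Vtelescope j (suc n) ⊕ Vtelescope j n ⊗ (t₁ ⊗ g₁)
  q⊗Vterm = begin
    mono 1 ⊗ (mono (Vexponent (j ℕ.+ 2) n) ⊗ C)
      ≈⟨ ≈-trans (≈-sym (⊗-assoc (mono 1) (mono (Vexponent (j ℕ.+ 2) n)) C))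
                 (⊗-congˡ C (≈-trans (mono-+ 1 (Vexponent (j ℕ.+ 2) n))
                                      (mono-split (Vexponent j n) (1 ℕ.+ 2 ℕ.* n) (sym (Vexponent-+2 j n))))) ⟩
    (x ⊗ t₁) ⊗ C
      ≈⟨ split x t₁ tB A g₁ B gB ⟩
    (x ⊗ (t₁ ⊗ tB)) ⊗ C ⊕ ((x ⊗ (A ⊗ B)) ⊗ (t₁ ⊗ g₁)) ⊗ (gB ⊗ oneMinus ((j ℕ.+ 2) ℕ.+ 2 ℕ.* n))
      ≈⟨ ⊕-cong (⊗-congˡ C (≈-trans (⊗-congʳ x (mono-+ (1 ℕ.+ 2 ℕ.* n) ((j ℕ.+ 2) ℕ.+ 2 ℕ.* n)))
                                     (≈-trans (mono-+ (Vexponent j n) _) (mono-cong (Vexponent-suc j n)))))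
                (⊗-congʳ ((x ⊗ (A ⊗ B)) ⊗ (t₁ ⊗ g₁)) (geomInv-inverseʳ ((j ℕ.+ 2) ℕ.+ 2 ℕ.* n) 1≤j+2+2n)) ⟩
    mono (Vexponent j (suc n)) ⊗ C ⊕ ((x ⊗ (A ⊗ B)) ⊗ (t₁ ⊗ g₁)) ⊗ one
      ≈⟨ ⊕-congʳ (mono (Vexponent j (suc n)) ⊗ C) (⊗-identityʳ ((x ⊗ (A ⊗ B)) ⊗ (t₁ ⊗ g₁))) ⟩
    Vtelescope j (suc n) ⊕ Vtelescope j n ⊗ (t₁ ⊗ g₁) ∎
    where
    open ≈-Reasoning
    C = (A ⊗ g₁) ⊗ (B ⊗ gB)
    1≤j+2+2n : 1 ≤ (j ℕ.+ 2) ℕ.+ 2 ℕ.* n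
    1≤j+2+2n = ℕP.≤-trans (s≤s z≤n) (ℕP.≤-trans (ℕP.m≤n+m 2 j) (ℕP.m≤m+n (j ℕ.+ 2) (2 ℕ.* n)))
    split : ∀ x t₁ t₂ A g₁ B g₂ → (x ⊗ t₁) ⊗ ((A ⊗ g₁) ⊗ (B ⊗ g₂))
          ≈ (x ⊗ (t₁ ⊗ t₂)) ⊗ ((A ⊗ g₁) ⊗ (B ⊗ g₂)) ⊕ ((x ⊗ (A ⊗ B)) ⊗ (t₁ ⊗ g₁)) ⊗ (g₂ ⊗ (one ⊕ ⊖ t₂))
    split = solve 7 (λ x t₁ t₂ A g₁ B g₂ → (x :* t₁) :* ((A :* g₁) :* (B :* g₂))
          := (x :* (t₁ :* t₂)) :* ((A :* g₁) :* (B :* g₂)) :+ ((x :* (A :* B)) :* (t₁ :* g₁)) :* (g₂ :* (con 1ℤ :- t₂))) ≈-refl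

  Vterm-difference : 1 ≤ j →
    oneMinus j ⊗ Vterm j n ⊕ ⊖ (mono 1 ⊗ Vterm (j ℕ.+ 2) n) ≈ Vtelescope j n ⊕ ⊖ Vtelescope j (suc n)
  Vterm-difference 1≤j = begin
    oneMinus j ⊗ Vterm j n ⊕ ⊖ (mono 1 ⊗ Vterm (j ℕ.+ 2) n)
      ≈⟨ ⊕-cong (oneMinus⊗Vterm 1≤j) (⊖-cong q⊗Vterm) ⟩
    S ⊗ g₁ ⊕ ⊖ (S′ ⊕ S ⊗ (t₁ ⊗ g₁))
      ≈⟨ regroup S S′ t₁ g₁ ⟩
    S ⊗ (g₁ ⊗ oneMinus (1 ℕ.+ 2 ℕ.* n)) ⊕ ⊖ S′
      ≈⟨ ⊕-cong (≈-trans (⊗-congʳ S (geomInv-inverseʳ (1 ℕ.+ 2 ℕ.* n) (s≤s z≤n))) (⊗-identityʳ S)) (≈-refl {⊖ S′}) ⟩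
    S ⊕ ⊖ S′ ∎
    where
    open ≈-Reasoning
    S  = Vtelescope j n
    S′ = Vtelescope j (suc n)
    regroup : ∀ S S′ t g → S ⊗ g ⊕ ⊖ (S′ ⊕ S ⊗ (t ⊗ g)) ≈ S ⊗ (g ⊗ (one ⊕ ⊖ t)) ⊕ ⊖ S′
    regroup = solve 4 (λ S S′ t g → S :* g :- (S′ :+ S :* (t :* g)) := S :* (g :* (con 1ℤ :- t)) :- S′) ≈-refl

V-functional-equation : ∀ j → 1 ≤ j → oneMinus j ⊗ V j ⊕ ⊖ (mono 1 ⊗ V (j ℕ.+ 2)) ≈ one
V-functional-equation j 1≤j = begin
  oneMinus j ⊗ V j ⊕ ⊖ (mono 1 ⊗ V (j ℕ.+ 2))
    ≈⟨ ⊕-cong (⊗-Σ∞ (oneMinus j) (Vterm-summable j))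
              (⊖-cong (⊗-Σ∞ (mono 1) (Vterm-summable (j ℕ.+ 2)))) ⟩
  Σ∞ (λ n → oneMinus j ⊗ Vterm j n) ⊕ ⊖ Σ∞ (λ n → mono 1 ⊗ Vterm (j ℕ.+ 2) n)
    ≈⟨ ≈-sym (Σ∞-difference (λ n → oneMinus j ⊗ Vterm j n) (λ n → mono 1 ⊗ Vterm (j ℕ.+ 2) n)) ⟩
  Σ∞ (λ n → oneMinus j ⊗ Vterm j n ⊕ ⊖ (mono 1 ⊗ Vterm (j ℕ.+ 2) n))
    ≈⟨ Σ∞-cong (λ n → Vterm-difference j n 1≤j) ⟩
  Σ∞ (λ n → Vtelescope j n ⊕ ⊖ Vtelescope j (suc n))
    ≈⟨ Σ∞-telescope (Vtelescope-summable j) ⟩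
  Vtelescope j 0
    ≈⟨ ≈-trans (⊗-congˡ (one ⊗ one) (≈-trans (mono-cong (exponent j)) mono-zero))
               (≈-trans (⊗-identityˡ (one ⊗ one)) (⊗-identityˡ one)) ⟩
  one ∎
  where
  open ≈-Reasoning
  exponent : ∀ j → j ℕ.* 0 ℕ.+ 2 ℕ.* 0 ℕ.* 0 ℕ.+ 0 ≡ 0
  exponent = ℕ-Solver.solve-∀

V-rec : ∀ j → 1 ≤ j → V j ≈ one ⊕ mono j ⊗ V j ⊕ mono 1 ⊗ V (j ℕ.+ 2)
V-rec j 1≤j = rearrange-recursion one (mono j) (mono 1) (V j) (V (j ℕ.+ 2)) (V-functional-equation j 1≤j)

U≈V : ∀ j → 1 ≤ j → U j ≈ V j
U≈V = contraction-unique U V (λ _ → one) 2 U-rec V-rec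

V1≈ω : V 1 ≈ ω
V1≈ω = Σ∞-cong (λ n → ⊗-cong (mono-cong (exponent n))
                             (λ N → cong (λ m → (invPochFin 1 2 m ⊗ invPochFin 1 2 m) N) (ℕP.+-comm 1 n)))
  where
  exponent : ∀ n → 1 ℕ.* n ℕ.+ 2 ℕ.* n ℕ.* n ℕ.+ n ≡ 2 ℕ.* n ℕ.* (n ℕ.+ 1)
  exponent = ℕ-Solver.solve-∀

-- F_{k,1} and q ω

Gterm : ℕ → PS
Gterm n = poch∞ (2 ℕ.* n ℕ.+ 2) 2 ⊗ ((invPoch∞ (2 ℕ.* n ℕ.+ 1) 2 ⊗ invPoch∞ (2 ℕ.* n ℕ.+ 1) 2) ⊗ mono (2 ℕ.* n ℕ.+ 1))

G : PS
G = Σ∞ Gterm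

eulerTerm : ℕ → ℕ → PS
eulerTerm s m = mono (s ℕ.* m) ⊗ invPochFin 2 2 m

binomialTerm : ℕ → ℕ → PS
binomialTerm s n = mono (s ℕ.* n) ⊗ (pochFin 1 2 n ⊗ invPochFin 2 2 n)

doubleTerm : ℕ → ℕ → PS
doubleTerm n m = eulerTerm 1 m ⊗ binomialTerm (2 ℕ.* m ℕ.+ 2) n

evenOverOdd : PS
evenOverOdd = poch∞ 2 2 ⊗ invPoch∞ 1 2

1≤2n+1 : ∀ n → 1 ≤ 2 ℕ.* n ℕ.+ 1
1≤2n+1 n = ℕP.m≤n+m 1 (2 ℕ.* n)

1≤2m+2 : ∀ m → 1 ≤ 2 ℕ.* m ℕ.+ 2
1≤2m+2 m = ℕP.≤-trans (s≤s z≤n) (ℕP.m≤n+m 2 (2 ℕ.* m))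

eulerTerm-summable : ∀ s → 1 ≤ s → Summable (eulerTerm s)
eulerTerm-summable s 1≤s = summable-mono⊗ (s ℕ.*_) (invPochFin 2 2) (λ n → n≤s*n n 1≤s)

binomialTerm-summable : ∀ s → 1 ≤ s → Summable (binomialTerm s)
binomialTerm-summable s 1≤s =
  summable-mono⊗ (s ℕ.*_) (λ n → pochFin 1 2 n ⊗ invPochFin 2 2 n) (λ n → n≤s*n n 1≤s)

doubleTerm-rearrange : ∀ n m →
  (mono (2 ℕ.* n) ⊗ (invPochFin 2 2 n ⊗ pochFin 1 2 n)) ⊗ eulerTerm (2 ℕ.* n ℕ.+ 1) m ≈ doubleTerm n m
doubleTerm-rearrange n m = begin
  (mono (2 ℕ.* n) ⊗ (I ⊗ P)) ⊗ (mono ((2 ℕ.* n ℕ.+ 1) ℕ.* m) ⊗ J)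
    ≈⟨ regroup (mono (2 ℕ.* n)) I P (mono ((2 ℕ.* n ℕ.+ 1) ℕ.* m)) J ⟩
  (mono (2 ℕ.* n) ⊗ mono ((2 ℕ.* n ℕ.+ 1) ℕ.* m)) ⊗ (J ⊗ (P ⊗ I))
    ≈⟨ ⊗-congˡ (J ⊗ (P ⊗ I)) (≈-trans (mono-+ (2 ℕ.* n) ((2 ℕ.* n ℕ.+ 1) ℕ.* m))
                                       (mono-split (1 ℕ.* m) ((2 ℕ.* m ℕ.+ 2) ℕ.* n) (exponent n m))) ⟩
  (mono (1 ℕ.* m) ⊗ mono ((2 ℕ.* m ℕ.+ 2) ℕ.* n)) ⊗ (J ⊗ (P ⊗ I))
    ≈⟨ ⊗-interchange (mono (1 ℕ.* m)) (mono ((2 ℕ.* m ℕ.+ 2) ℕ.* n)) J (P ⊗ I) ⟩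
  doubleTerm n m ∎
  where
  open ≈-Reasoning
  I = invPochFin 2 2 n
  P = pochFin 1 2 n
  J = invPochFin 2 2 m
  exponent : ∀ n m → 1 ℕ.* m ℕ.+ (2 ℕ.* m ℕ.+ 2) ℕ.* n ≡ 2 ℕ.* n ℕ.+ (2 ℕ.* n ℕ.+ 1) ℕ.* m
  exponent = ℕ-Solver.solve-∀
  regroup : ∀ X I P Y J → (X ⊗ (I ⊗ P)) ⊗ (Y ⊗ J) ≈ (X ⊗ Y) ⊗ (J ⊗ (P ⊗ I))
  regroup = solve 5 (λ X I P Y J → (X :* (I :* P)) :* (Y :* J) := (X :* Y) :* (J :* (P :* I))) ≈-refl

Gterm-expand : ∀ n → Gterm n ≈ mono 1 ⊗ (evenOverOdd ⊗ Σ∞ (doubleTerm n))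
Gterm-expand n = begin
  Gterm n
    ≈⟨ ⊗-cong even-shift (⊗-cong (⊗-cong odd-shift euler) (mono-split 1 (2 ℕ.* n) (ℕP.+-comm 1 (2 ℕ.* n)))) ⟩
  (I ⊗ poch∞ 2 2) ⊗ (((P ⊗ invPoch∞ 1 2) ⊗ E) ⊗ (mono 1 ⊗ mono (2 ℕ.* n)))
    ≈⟨ regroup I (poch∞ 2 2) P (invPoch∞ 1 2) E (mono 1) (mono (2 ℕ.* n)) ⟩
  mono 1 ⊗ (evenOverOdd ⊗ ((mono (2 ℕ.* n) ⊗ (I ⊗ P)) ⊗ E))
    ≈⟨ ⊗-congʳ (mono 1) (⊗-congʳ evenOverOdd
         (⊗-Σ∞ (mono (2 ℕ.* n) ⊗ (I ⊗ P)) (eulerTerm-summable (2 ℕ.* n ℕ.+ 1) (1≤2n+1 n)))) ⟩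
  mono 1 ⊗ (evenOverOdd ⊗ Σ∞ (λ m → (mono (2 ℕ.* n) ⊗ (I ⊗ P)) ⊗ eulerTerm (2 ℕ.* n ℕ.+ 1) m))
    ≈⟨ ⊗-congʳ (mono 1) (⊗-congʳ evenOverOdd (Σ∞-cong (doubleTerm-rearrange n))) ⟩
  mono 1 ⊗ (evenOverOdd ⊗ Σ∞ (doubleTerm n)) ∎
  where
  open ≈-Reasoning
  I = invPochFin 2 2 n
  P = pochFin 1 2 n
  E = Σ∞ (eulerTerm (2 ℕ.* n ℕ.+ 1))
  even-shift : poch∞ (2 ℕ.* n ℕ.+ 2) 2 ≈ I ⊗ poch∞ 2 2
  even-shift = ≈-trans (≡⇒≈ (cong (λ s → poch∞ s 2) (ℕP.+-comm (2 ℕ.* n) 2))) (poch∞-shift n 2 2 (s≤s z≤n))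
  odd-shift : invPoch∞ (2 ℕ.* n ℕ.+ 1) 2 ≈ P ⊗ invPoch∞ 1 2
  odd-shift = ≈-trans (≡⇒≈ (cong (λ s → invPoch∞ s 2) (ℕP.+-comm (2 ℕ.* n) 1))) (invPoch∞-shift n 1 2 (s≤s z≤n))
  euler : invPoch∞ (2 ℕ.* n ℕ.+ 1) 2 ≈ E
  euler = invPoch∞-euler (2 ℕ.* n ℕ.+ 1) 2 (1≤2n+1 n)
  regroup : ∀ I P₂ P IP₁ E X₁ X₂ →
    (I ⊗ P₂) ⊗ (((P ⊗ IP₁) ⊗ E) ⊗ (X₁ ⊗ X₂)) ≈ X₁ ⊗ ((P₂ ⊗ IP₁) ⊗ ((X₂ ⊗ (I ⊗ P)) ⊗ E))
  regroup = solve 7 (λ I P₂ P IP₁ E X₁ X₂ →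
    (I :* P₂) :* (((P :* IP₁) :* E) :* (X₁ :* X₂)) := X₁ :* ((P₂ :* IP₁) :* ((X₂ :* (I :* P)) :* E))) ≈-refl

binomialLimit : ℕ → PS
binomialLimit m = poch∞ (2 ℕ.* m ℕ.+ 2 ℕ.+ 1) 2 ⊗ invPoch∞ (2 ℕ.* m ℕ.+ 2) 2

evenOverOdd⊗binomialLimit : ∀ m → evenOverOdd ⊗ (eulerTerm 1 m ⊗ binomialLimit m) ≈ Uterm 1 m
evenOverOdd⊗binomialLimit m = begin
  (poch∞ 2 2 ⊗ invPoch∞ 1 2) ⊗ ((X ⊗ J) ⊗ (P₃ ⊗ invPoch∞ (2 ℕ.* m ℕ.+ 2) 2))
    ≈⟨ regroup (poch∞ 2 2) (invPoch∞ 1 2) X J P₃ (invPoch∞ (2 ℕ.* m ℕ.+ 2) 2) ⟩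
  X ⊗ ((J ⊗ (poch∞ 2 2 ⊗ invPoch∞ (2 ℕ.* m ℕ.+ 2) 2)) ⊗ (P₃ ⊗ invPoch∞ 1 2))
    ≈⟨ ⊗-congʳ X (⊗-cong (⊗-congʳ J even-ratio) odd-ratio) ⟩
  X ⊗ ((J ⊗ pochFin 2 2 m) ⊗ invPochFin 1 2 (suc m))
    ≈⟨ ⊗-congʳ X (⊗-congˡ (invPochFin 1 2 (suc m))
         (≈-trans (⊗-comm J (pochFin 2 2 m)) (pochFin-inverse 2 2 m (s≤s z≤n)))) ⟩
  X ⊗ (one ⊗ invPochFin 1 2 (suc m))
    ≈⟨ ⊗-congʳ X (⊗-identityˡ (invPochFin 1 2 (suc m))) ⟩
  Uterm 1 m ∎
  where
  open ≈-Reasoning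
  X = mono (1 ℕ.* m)
  J = invPochFin 2 2 m
  P₃ = poch∞ (2 ℕ.* m ℕ.+ 2 ℕ.+ 1) 2
  exponent : ∀ m → 2 ℕ.* m ℕ.+ 2 ℕ.+ 1 ≡ 1 ℕ.+ 2 ℕ.* suc m
  exponent = ℕ-Solver.solve-∀
  even-ratio : poch∞ 2 2 ⊗ invPoch∞ (2 ℕ.* m ℕ.+ 2) 2 ≈ pochFin 2 2 m
  even-ratio = ≈-trans (⊗-congʳ (poch∞ 2 2) (≡⇒≈ (cong (λ s → invPoch∞ s 2) (ℕP.+-comm (2 ℕ.* m) 2))))
                       (poch∞/poch∞-shift m 2 2 (s≤s z≤n))
  odd-ratio : P₃ ⊗ invPoch∞ 1 2 ≈ invPochFin 1 2 (suc m)
  odd-ratio = ≈-trans (⊗-congˡ (invPoch∞ 1 2) (≡⇒≈ (cong (λ s → poch∞ s 2) (exponent m))))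
                      (poch∞-shift/poch∞ (suc m) 1 2 (s≤s z≤n))
  regroup : ∀ P₂ IP₁ X J P₃ IP₂ →
    (P₂ ⊗ IP₁) ⊗ ((X ⊗ J) ⊗ (P₃ ⊗ IP₂)) ≈ X ⊗ ((J ⊗ (P₂ ⊗ IP₂)) ⊗ (P₃ ⊗ IP₁))
  regroup = solve 6 (λ P₂ IP₁ X J P₃ IP₂ →
    (P₂ :* IP₁) :* ((X :* J) :* (P₃ :* IP₂)) := X :* ((J :* (P₂ :* IP₂)) :* (P₃ :* IP₁))) ≈-refl

G≈q⊗U : G ≈ mono 1 ⊗ U 1
G≈q⊗U = begin
  Σ∞ Gterm
    ≈⟨ Σ∞-cong Gterm-expand ⟩
  Σ∞ (λ n → mono 1 ⊗ (evenOverOdd ⊗ Σ∞ (doubleTerm n)))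
    ≈⟨ ≈-sym (⊗-Σ∞ (mono 1) (λ n → ∣-⊗ˡ evenOverOdd (inner-divisible n))) ⟩
  mono 1 ⊗ Σ∞ (λ n → evenOverOdd ⊗ Σ∞ (doubleTerm n))
    ≈⟨ ⊗-congʳ (mono 1) (≈-sym (⊗-Σ∞ evenOverOdd inner-divisible)) ⟩
  mono 1 ⊗ (evenOverOdd ⊗ Σ∞ (λ n → Σ∞ (doubleTerm n)))
    ≈⟨ ⊗-congʳ (mono 1) (⊗-congʳ evenOverOdd (≈-trans (Σ∞-swap doubleTerm) (Σ∞-cong binomial-sum))) ⟩
  mono 1 ⊗ (evenOverOdd ⊗ Σ∞ (λ m → eulerTerm 1 m ⊗ binomialLimit m))
    ≈⟨ ⊗-congʳ (mono 1) (≈-trans (⊗-Σ∞ evenOverOdd (λ m → ∣-⊗ʳ (eulerTerm-summable 1 (s≤s z≤n) m) (binomialLimit m)))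
                                 (Σ∞-cong evenOverOdd⊗binomialLimit)) ⟩
  mono 1 ⊗ U 1 ∎
  where
  open ≈-Reasoning
  inner-divisible : ∀ n → q^ n ∣ Σ∞ (doubleTerm n)
  inner-divisible n = ∣-Σ∞ (λ m → ∣-⊗ˡ (eulerTerm 1 m) (binomialTerm-summable (2 ℕ.* m ℕ.+ 2) (1≤2m+2 m) n))
  binomial-sum : ∀ m → Σ∞ (λ n → doubleTerm n m) ≈ eulerTerm 1 m ⊗ binomialLimit m
  binomial-sum m = ≈-trans
    (≈-sym (⊗-Σ∞ (eulerTerm 1 m) (binomialTerm-summable (2 ℕ.* m ℕ.+ 2) (1≤2m+2 m))))
    (⊗-congʳ (eulerTerm 1 m) (q-binomial-mono 1 (2 ℕ.* m ℕ.+ 2) 2 (1≤2m+2 m)))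

F≈[]G : ∀ k → F k ≈[ 2 ℕ.* k ] G
F≈[]G k N N<2k = sumBelow-cong (suc N) (λ n → Fterm≈[]Gterm n N (ℕP.<-≤-trans N<2k (ℕP.m≤n+m (2 ℕ.* k) (2 ℕ.* n))))
  where
  Fterm≈[]Gterm : ∀ n → Fterm k n ≈[ 2 ℕ.* n ℕ.+ 2 ℕ.* k ] Gterm n
  Fterm≈[]Gterm n = ≈[]-trans
    (≈[]-⊗ (≈[]-⊗ (≈⇒≈[] (≈-refl {poch∞ (2 ℕ.* n ℕ.+ 2) 2})) (poch∞≈[]one (2 ℕ.* n ℕ.+ 2 ℕ.* k) 2))
            (≈⇒≈[] (≈-refl {R})))
    (≈⇒≈[] (⊗-congˡ R (⊗-identityʳ (poch∞ (2 ℕ.* n ℕ.+ 2) 2))))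
    where
    R = (invPoch∞ (2 ℕ.* n ℕ.+ 1) 2 ⊗ invPoch∞ (2 ℕ.* n ℕ.+ 1) 2) ⊗ mono (2 ℕ.* n ℕ.+ 1)

G≈qω : G ≈ qω
G≈qω = ≈-trans G≈q⊗U (⊗-congʳ (mono 1) (≈-trans (U≈V 1 (s≤s z≤n)) V1≈ω))

theorem1p4 : (N : ℕ) → ∃[ K ] ((k : ℕ) → K ≤ k → F k N ≡ qω N)
theorem1p4 N = suc N , λ k N<k → begin
  F k N ≡⟨ F≈[]G k N (ℕP.<-≤-trans N<k (ℕP.m≤n*m k 2)) ⟩
  G N   ≡⟨ G≈qω N ⟩
  qω N  ∎
  where open ≡-Reasoning
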